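{- Let $n\ge2$, $\mathbf{k}=(k_1,\ldots,k_n)$ a tuple of positive integers and $\mathbf{k}\setminus k_n=(k_1,\ldots,k_{n-1})$. Then for all $i\ge1$, $$A_{\mathbf{k},i}=i\,A_{\mathbf{k}\setminus k_n,i}+(k_1+\cdots+k_{n-1}+1-(i-1))\,A_{\mathbf{k}\setminus k_n,i-1},$$ and moreover $A_{(k),1}=1$ for every positive integer $k$, and $A_{\mathbf{k},i}=0$ if $i=0$ or $i>n$. Furthermore $$G_{\mathbf{k}}(x)=\frac{x}{(1-x)^{k_n-1}}\frac{d}{dx}G_{\mathbf{k}\setminus k_n}(x),\qquad g_{\mathbf{k}}(x)=\frac{x^{k_n}}{(1-x)^{k_n-1}}\frac{d}{dx}g_{\mathbf{k}\setminus k_n}(x).$$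
   Context: For a tuple $\mathbf{k}=(k_1,\ldots,k_n)$ of positive integers, $K=k_1+\cdots+k_n$: a Stirling permutation of $\{1^{k_1},\ldots,n^{k_n}\}$ is a word $\sigma(1)\cdots\sigma(K)$ containing each $i$ exactly $k_i$ times such that $\sigma(i)=\sigma(j)$ and $i<s<j$ imply $\sigma(s)\ge\sigma(i)$. An index $i\in\{1,\ldots,K\}$ is a descent if either $i<K$ and $\sigma(i)>\sigma(i+1)$, or $i=K$. $A_{\mathbf{k},i}$ is the number of Stirling permutations of this multiset with exactly $i$ descents. $G_{\mathbf{k}}(x)=\frac{\sum_{i=1}^{n}A_{\mathbf{k},i}x^i}{(1-x)^{K+1}}$ and $g_{\mathbf{k}}(x)=\frac{\sum_{i=K-n+1}^{K}A_{\mathbf{k},K+1-i}x^i}{(1-x)^{K+1}}$. -}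

module Defs where

open import Data.Bool using (Bool; true; false; _∧_; _∨_; if_then_else_)
open import Data.Nat using (ℕ; zero; suc; _+_; _*_; _∸_; _≡ᵇ_; _≤ᵇ_; _<ᵇ_)
open import Data.List using (List; []; _∷_; length; map; upTo; concatMap; filterᵇ)
open import Data.Bool.ListAction using (and)
open import Data.Nat.ListAction using (sum)
open import Data.Vec as Vec using (Vec)

Σ< : ℕ → (ℕ → ℕ) → ℕ
Σ< n f = sum (map f (upTo n))

-- p-th (0-based) letter of a word, i.e. σ(p+1); default 0 out of range
at : List ℕ → ℕ → ℕ
at []       _       = 0
at (x ∷ xs) zero    = x
at (x ∷ xs) (suc p) = at xs p

words : ℕ → ℕ → List (List ℕ)
words n zero    = [] ∷ []
words n (suc L) = concatMap (λ w → map (λ a → suc a ∷ w) (upTo n)) (words n L)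

occ : ℕ → List ℕ → ℕ
occ a w = length (filterᵇ (λ b → a ≡ᵇ b) w)

multFrom : ℕ → List ℕ → List ℕ → Bool
multFrom j []       w = true
multFrom j (c ∷ cs) w = (occ (suc j) w ≡ᵇ c) ∧ multFrom (suc j) cs w

hasMultiplicities : ∀ {n} → Vec ℕ n → List ℕ → Bool
hasMultiplicities k w = multFrom 0 (Vec.toList k) w

isStirling : List ℕ → Bool
isStirling w =
  and (map (λ b → and (map (λ s → and (map (λ a →
        if (a <ᵇ s) ∧ (s <ᵇ b) ∧ (at w a ≡ᵇ at w b)
        then at w a ≤ᵇ at w s else true)
      (upTo L))) (upTo L))) (upTo L))
  where L = length w

-- number of descents: positions i ∈ {1,…,K} with
-- (i < K and σ(i) > σ(i+1)) or i = K.   (p = i - 1 below)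
descents : List ℕ → ℕ
descents w = length (filterᵇ isDes (upTo L))
  where
  L = length w
  isDes : ℕ → Bool
  isDes p = ((suc p <ᵇ L) ∧ (at w (suc p) <ᵇ at w p)) ∨ (suc p ≡ᵇ L)

total : ∀ {n} → Vec ℕ n → ℕ
total k = Vec.sum k

A : ∀ {n} → Vec ℕ n → ℕ → ℕ
A {n} k i = length (filterᵇ
  (λ w → hasMultiplicities k w ∧ isStirling w ∧ (descents w ≡ᵇ i))
  (words n (total k)))

-- Formal power series with coefficients in ℕ (coefficient of x^m)

Series : Set
Series = ℕ → ℕ

_⊛_ : Series → Series → Series
(f ⊛ g) m = Σ< (suc m) (λ j → f j * g (m ∸ j))

one : Series
one zero    = 1
one (suc _) = 0

-- 1/(1-x) = 1 + x + x² + ⋯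
geom : Series
geom _ = 1

-- 1/(1-x)^r
invPow : ℕ → Series
invPow zero    = one
invPow (suc r) = geom ⊛ invPow r

xPow : ℕ → Series → Series
xPow j f m = if j ≤ᵇ m then f (m ∸ j) else 0

deriv : Series → Series
deriv f m = suc m * f (suc m)

-- numerator of G_k : Σ_{i=1}^{n} A_{k,i} x^i
numG : ∀ {n} → Vec ℕ n → Series
numG {n} k i = if (1 ≤ᵇ i) ∧ (i ≤ᵇ n) then A k i else 0

-- numerator of g_k : Σ_{i=K-n+1}^{K} A_{k,K+1-i} x^i
numg : ∀ {n} → Vec ℕ n → Series
numg {n} k i = if (suc (total k) ∸ n ≤ᵇ i) ∧ (i ≤ᵇ total k)
               then A k (suc (total k) ∸ i) else 0

G : ∀ {n} → Vec ℕ n → Series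
G k = numG k ⊛ invPow (suc (total k))

g : ∀ {n} → Vec ℕ n → Series
g k = numg k ⊛ invPow (suc (total k))

module Submission where

-- In a Stirling permutation of {1^k₁, …, n^kₙ} the kₙ copies of the largest letter n form one
-- contiguous block; deleting it gives a Stirling permutation of k ∖ kₙ, and conversely the block may be
-- inserted into any of the K′ + 1 gaps of such a permutation (K′ = k₁ + ⋯ + kₙ₋₁). Inserting it right
-- after a descent (the last letter counts as one) keeps the number of descents, any other gap adds one;
-- this is the recurrence. For the series, with N = Σ A_{k,i} xⁱ and M = Σ A_{k∖kₙ,i} xⁱ, comparing
-- partial sums of the recurrence gives N / (1 - x) = x (M′ + (K′ + 1) M / (1 - x)), and likewise for the
-- reversed numerators with x^kₙ in place of x; the quotient rule
-- (M / (1 - x)^(K′+1))′ = (M′ + (K′ + 1) M / (1 - x)) / (1 - x)^(K′+1) turns this into the formulas.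

open import Defs

-- An anonymous module, so that its imports stay local: the statement of lemma1 below needs the names
-- All (of vectors) and +_ (of integers), which clash with the list All and with sections such as (x +_).
module _ where

  open import Data.Bool using (Bool; true; false; T; _∧_; _∨_; if_then_else_)
  open import Data.Bool.Properties using (T?; T-≡; T-∧; ∧-assoc; ∧-identityʳ; ∧-zeroʳ; ∨-identityʳ)
  open import Data.Bool.ListAction using (and)
  open import Data.Empty using (⊥-elim)
  open import Data.Unit using (⊤; tt)
  open import Data.Nat
    using (ℕ; zero; suc; _+_; _*_; _∸_; _≤_; _<_; z≤n; s≤s; s≤s⁻¹; _≡ᵇ_; _<ᵇ_; _≤ᵇ_; _≟_; _≤?_)
  open import Data.Nat.Properties
  open import Data.Nat.ListAction using (sum)
  open import Data.Nat.Tactic.RingSolver using (solve-∀)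
  open import Data.List
    using (List; []; _∷_; length; map; upTo; filterᵇ; _++_; replicate; concat; cartesianProduct; cartesianProductWith)
  open import Data.List.Properties
    using (map-applyUpTo; upTo-∷ʳ; length-++; length-replicate; ∷-injective; ∷-injectiveˡ; ++-cancelˡ)
  open import Data.List.Membership.Propositional using (_∈_)
  open import Data.List.Membership.Propositional.Properties
    using (∈-upTo⁺; ∈-upTo⁻; ∈-filter⁺; ∈-filter⁻; ∈-map⁺; ∈-map⁻; ∈-++⁺ʳ;
           ∈-cartesianProduct⁺; ∈-cartesianProduct⁻; ∈-cartesianProductWith⁺; ∈-cartesianProductWith⁻)
  open import Data.List.Membership.Propositional.Properties.WithK using (unique∧set⇒bag)
  open import Data.List.Relation.Binary.BagAndSetEquality using (∼bag⇒↭)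
  open import Data.List.Relation.Binary.Permutation.Propositional.Properties using (↭-length)
  open import Data.List.Relation.Unary.Any using (here; there)
  open import Data.List.Relation.Unary.All as All using (All; []; _∷_)
  open import Data.List.Relation.Unary.All.Properties using (++⁻ˡ; ++⁻ʳ; ++⁺; all⁺; all⁻; replicate⁺)
  open import Data.List.Relation.Unary.AllPairs using ([]; _∷_)
  open import Data.List.Relation.Unary.Unique.Propositional using (Unique)
  open import Data.List.Relation.Unary.Unique.Propositional.Properties
    using (cartesianProduct⁺; cartesianProductWith⁺; upTo⁺; filter⁺)
  open import Data.Vec as Vec using (Vec; []; _∷_; _∷ʳ_; init; last)
  open import Data.Vec.Properties using (toList-∷ʳ; length-toList)
  open import Data.Vec.Relation.Unary.All as VecAll using ([]; _∷_)
  open import Data.Product using (_×_; _,_; proj₁; proj₂; ∃)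
  open import Function using (_∘_; id)
  open import Function.Bundles using (mk⇔; Equivalence)
  open import Relation.Binary.PropositionalEquality
  import Relation.Binary.Reasoning.Setoid as SetoidReasoning
  open import Relation.Nullary using (yes; no)

  -- Finite sums

  ∑ : {A : Set} → List A → (A → ℕ) → ℕ
  ∑ []       f = 0
  ∑ (x ∷ xs) f = f x + ∑ xs f

  ∑< : ℕ → (ℕ → ℕ) → ℕ
  ∑< n f = ∑ (upTo n) f

  sum-map : {A : Set} (f : A → ℕ) (xs : List A) → sum (map f xs) ≡ ∑ xs f
  sum-map f []       = refl
  sum-map f (x ∷ xs) = cong (f x +_) (sum-map f xs)

  ∑-++ : {A : Set} (xs ys : List A) (f : A → ℕ) → ∑ (xs ++ ys) f ≡ ∑ xs f + ∑ ys f
  ∑-++ []       ys f = refl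
  ∑-++ (x ∷ xs) ys f = trans (cong (f x +_) (∑-++ xs ys f)) (sym (+-assoc (f x) _ _))

  ∑-map : {A B : Set} (g : A → B) (xs : List A) (f : B → ℕ) → ∑ (map g xs) f ≡ ∑ xs (f ∘ g)
  ∑-map g []       f = refl
  ∑-map g (x ∷ xs) f = cong (f (g x) +_) (∑-map g xs f)

  ∑-cong : {A : Set} (xs : List A) {f g : A → ℕ} → (∀ x → x ∈ xs → f x ≡ g x) → ∑ xs f ≡ ∑ xs g
  ∑-cong []       h = refl
  ∑-cong (x ∷ xs) h = cong₂ _+_ (h x (here refl)) (∑-cong xs (λ y y∈ → h y (there y∈)))

  ∑-zero : {A : Set} (xs : List A) {f : A → ℕ} → (∀ x → x ∈ xs → f x ≡ 0) → ∑ xs f ≡ 0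
  ∑-zero []       h = refl
  ∑-zero (x ∷ xs) h = cong₂ _+_ (h x (here refl)) (∑-zero xs (λ y y∈ → h y (there y∈)))

  ∑-+ : {A : Set} (xs : List A) (f g : A → ℕ) → ∑ xs (λ x → f x + g x) ≡ ∑ xs f + ∑ xs g
  ∑-+ []       f g = refl
  ∑-+ (x ∷ xs) f g rewrite ∑-+ xs f g = +-interchange (f x) (g x) (∑ xs f) (∑ xs g)
    where
    +-interchange : ∀ a b c d → a + b + (c + d) ≡ a + c + (b + d)
    +-interchange = solve-∀

  ∑-*ˡ : {A : Set} (xs : List A) (c : ℕ) (f : A → ℕ) → ∑ xs (λ x → c * f x) ≡ c * ∑ xs f
  ∑-*ˡ []       c f = sym (*-zeroʳ c)
  ∑-*ˡ (x ∷ xs) c f = trans (cong (c * f x +_) (∑-*ˡ xs c f)) (sym (*-distribˡ-+ c (f x) _))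

  ∑-*ʳ : {A : Set} (xs : List A) (c : ℕ) (f : A → ℕ) → ∑ xs (λ x → f x * c) ≡ ∑ xs f * c
  ∑-*ʳ xs c f = trans (∑-cong xs (λ x _ → *-comm (f x) c)) (trans (∑-*ˡ xs c f) (*-comm c _))

  ∑-cartesianProduct : {A B : Set} (xs : List A) (ys : List B) (f : A × B → ℕ) →
    ∑ (cartesianProduct xs ys) f ≡ ∑ xs (λ x → ∑ ys (λ y → f (x , y)))
  ∑-cartesianProduct []       ys f = refl
  ∑-cartesianProduct (x ∷ xs) ys f =
    trans (∑-++ (map (x ,_) ys) _ f) (cong₂ _+_ (∑-map (x ,_) ys f) (∑-cartesianProduct xs ys f))

  Σ<≡∑< : ∀ n f → Σ< n f ≡ ∑< n f
  Σ<≡∑< n f = sum-map f (upTo n)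

  ∑<-suc : ∀ n f → ∑< (suc n) f ≡ f 0 + ∑< n (f ∘ suc)
  ∑<-suc n f = cong (f 0 +_) (trans (cong (λ l → ∑ l f) (sym (map-applyUpTo id suc n))) (∑-map suc (upTo n) f))

  ∑<-last : ∀ n f → ∑< (suc n) f ≡ ∑< n f + f n
  ∑<-last n f = trans (cong (λ l → ∑ l f) (sym (upTo-∷ʳ n)))
    (trans (∑-++ (upTo n) (n ∷ []) f) (cong (∑< n f +_) (+-identityʳ (f n))))

  ∑<-cong : ∀ n {f g} → (∀ i → i < n → f i ≡ g i) → ∑< n f ≡ ∑< n g
  ∑<-cong n h = ∑-cong (upTo n) (λ i i∈ → h i (∈-upTo⁻ i∈))

  ∑<-zero : ∀ n {f} → (∀ i → i < n → f i ≡ 0) → ∑< n f ≡ 0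
  ∑<-zero n h = ∑-zero (upTo n) (λ i i∈ → h i (∈-upTo⁻ i∈))

  ∑<-const-1 : ∀ n → ∑< n (λ _ → 1) ≡ n
  ∑<-const-1 zero    = refl
  ∑<-const-1 (suc n) = trans (∑<-suc n (λ _ → 1)) (cong suc (∑<-const-1 n))

  ∑<-+ : ∀ a b f → ∑< (a + b) f ≡ ∑< a f + ∑< b (λ i → f (a + i))
  ∑<-+ zero    b f = refl
  ∑<-+ (suc a) b f = begin
    ∑< (suc (a + b)) f                                ≡⟨ ∑<-suc (a + b) f ⟩
    f 0 + ∑< (a + b) (f ∘ suc)                        ≡⟨ cong (f 0 +_) (∑<-+ a b (f ∘ suc)) ⟩
    f 0 + (∑< a (f ∘ suc) + ∑< b (λ i → f (suc a + i))) ≡⟨ sym (+-assoc (f 0) _ _) ⟩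
    f 0 + ∑< a (f ∘ suc) + ∑< b (λ i → f (suc a + i))   ≡⟨ cong (_+ ∑< b (λ i → f (suc a + i))) (sym (∑<-suc a f)) ⟩
    ∑< (suc a) f + ∑< b (λ i → f (suc a + i))           ∎
    where open ≡-Reasoning

  ∑<-reverse : ∀ n f → ∑< n f ≡ ∑< n (λ j → f (n ∸ suc j))
  ∑<-reverse zero    f = refl
  ∑<-reverse (suc n) f = begin
    ∑< (suc n) f                                   ≡⟨ ∑<-suc n f ⟩
    f 0 + ∑< n (f ∘ suc)                           ≡⟨ cong (f 0 +_) (∑<-reverse n (f ∘ suc)) ⟩
    f 0 + ∑< n (λ j → f (suc (n ∸ suc j)))         ≡⟨ cong (f 0 +_) (∑<-cong n (λ j j< → cong f (sym (+-∸-assoc 1 j<)))) ⟩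
    f 0 + ∑< n (λ j → f (suc n ∸ suc j))           ≡⟨ +-comm (f 0) _ ⟩
    ∑< n (λ j → f (suc n ∸ suc j)) + f 0           ≡⟨ cong (λ z → ∑< n (λ j → f (suc n ∸ suc j)) + f z) (sym (n∸n≡0 n)) ⟩
    ∑< n (λ j → f (suc n ∸ suc j)) + f (n ∸ n)     ≡⟨ sym (∑<-last n (λ j → f (suc n ∸ suc j))) ⟩
    ∑< (suc n) (λ j → f (suc n ∸ suc j))           ∎
    where open ≡-Reasoning

  ∑<-triangle : ∀ t (F : ℕ → ℕ → ℕ) →
    ∑< (suc t) (λ i → ∑< (suc i) (λ j → F j i)) ≡ ∑< (suc t) (λ j → ∑< (suc (t ∸ j)) (λ l → F j (j + l)))
  ∑<-triangle zero    F = refl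
  ∑<-triangle (suc t) F = begin
    ∑< (suc (suc t)) (λ i → ∑< (suc i) (λ j → F j i))
      ≡⟨ ∑<-last (suc t) (λ i → ∑< (suc i) (λ j → F j i)) ⟩
    ∑< (suc t) (λ i → ∑< (suc i) (λ j → F j i)) + ∑< (suc (suc t)) (λ j → F j (suc t))
      ≡⟨ cong₂ _+_ (∑<-triangle t F) (∑<-last (suc t) (λ j → F j (suc t))) ⟩
    ∑< (suc t) (R t) + (∑< (suc t) (λ j → F j (suc t)) + F (suc t) (suc t))
      ≡⟨ +-assoc (∑< (suc t) (R t)) _ _ ⟨
    ∑< (suc t) (R t) + ∑< (suc t) (λ j → F j (suc t)) + F (suc t) (suc t)
      ≡⟨ cong (_+ F (suc t) (suc t)) (∑-+ (upTo (suc t)) (R t) (λ j → F j (suc t))) ⟨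
    ∑< (suc t) (λ j → R t j + F j (suc t)) + F (suc t) (suc t)
      ≡⟨ cong₂ _+_ (∑<-cong (suc t) extend) last-row ⟩
    ∑< (suc t) (R (suc t)) + R (suc t) (suc t)
      ≡⟨ ∑<-last (suc t) (R (suc t)) ⟨
    ∑< (suc (suc t)) (R (suc t))
      ∎
    where
    open ≡-Reasoning
    R : ℕ → ℕ → ℕ
    R t j = ∑< (suc (t ∸ j)) (λ l → F j (j + l))
    extend : ∀ j → j < suc t → R t j + F j (suc t) ≡ R (suc t) j
    extend j j<
      rewrite +-∸-assoc 1 (s≤s⁻¹ j<)
            | sym (cong (F j) (trans (+-suc j (t ∸ j)) (cong suc (m+[n∸m]≡n (s≤s⁻¹ j<)))))
      = sym (∑<-last (suc (t ∸ j)) (λ l → F j (j + l)))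
    last-row : F (suc t) (suc t) ≡ R (suc t) (suc t)
    last-row rewrite n∸n≡0 t | +-identityʳ t = sym (+-identityʳ _)

  ⟦_⟧ : Bool → ℕ
  ⟦ true  ⟧ = 1
  ⟦ false ⟧ = 0

  T⇒≡true : ∀ {b} → T b → b ≡ true
  T⇒≡true = Equivalence.to T-≡

  ≡true⇒T : ∀ {b} → b ≡ true → T b
  ≡true⇒T = Equivalence.from T-≡

  T-∧⁻ : ∀ {x y} → T (x ∧ y) → T x × T y
  T-∧⁻ = Equivalence.to T-∧

  T-∧⁺ : ∀ {x y} → T x → T y → T (x ∧ y)
  T-∧⁺ tx ty = Equivalence.from T-∧ (tx , ty)

  <ᵇ-true : ∀ {m n} → m < n → (m <ᵇ n) ≡ true
  <ᵇ-true m<n = T⇒≡true (<⇒<ᵇ m<n)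

  <ᵇ-false : ∀ {m n} → n ≤ m → (m <ᵇ n) ≡ false
  <ᵇ-false {m} {n} n≤m with m <ᵇ n in eq
  ... | false = refl
  ... | true  = ⊥-elim (<⇒≱ (<ᵇ⇒< m n (≡true⇒T eq)) n≤m)

  ≡ᵇ-false : ∀ {m n} → m ≢ n → (m ≡ᵇ n) ≡ false
  ≡ᵇ-false {m} {n} m≢n with m ≡ᵇ n in eq
  ... | false = refl
  ... | true  = ⊥-elim (m≢n (≡ᵇ⇒≡ m n (≡true⇒T eq)))

  ≡ᵇ-refl : ∀ n → (n ≡ᵇ n) ≡ true
  ≡ᵇ-refl n = T⇒≡true (≡⇒≡ᵇ n n refl)

  ≤ᵇ-false : ∀ {m n} → n < m → (m ≤ᵇ n) ≡ false
  ≤ᵇ-false {m} {n} n<m with m ≤ᵇ n in eq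
  ... | false = refl
  ... | true  = ⊥-elim (<⇒≱ n<m (≤ᵇ⇒≤ m n (≡true⇒T eq)))

  ≤ᵇ-true : ∀ {m n} → m ≤ n → (m ≤ᵇ n) ≡ true
  ≤ᵇ-true m≤n = T⇒≡true (≤⇒≤ᵇ m≤n)

  ≤ᵇ≡false⇒> : ∀ {m n} → (m ≤ᵇ n) ≡ false → n < m
  ≤ᵇ≡false⇒> eq = ≰⇒> (λ m≤n → subst T eq (≤⇒≤ᵇ m≤n))

  length-filterᵇ : {A : Set} (p : A → Bool) (xs : List A) → length (filterᵇ p xs) ≡ ∑ xs (⟦_⟧ ∘ p)
  length-filterᵇ p []       = refl
  length-filterᵇ p (x ∷ xs) with p x
  ... | true  = cong suc (length-filterᵇ p xs)
  ... | false = length-filterᵇ p xs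

  ∑-⟦∧⟧-filterᵇ : {A : Set} (p q r : A → Bool) (xs : List A) →
    ∑ xs (λ x → ⟦ p x ∧ (q x ∧ r x) ⟧) ≡ ∑ (filterᵇ (λ x → p x ∧ q x) xs) (⟦_⟧ ∘ r)
  ∑-⟦∧⟧-filterᵇ p q r []       = refl
  ∑-⟦∧⟧-filterᵇ p q r (x ∷ xs) with p x | q x
  ... | true  | true  = cong (⟦ r x ⟧ +_) (∑-⟦∧⟧-filterᵇ p q r xs)
  ... | true  | false = ∑-⟦∧⟧-filterᵇ p q r xs
  ... | false | _     = ∑-⟦∧⟧-filterᵇ p q r xs

  ∈-filterᵇ⁺ : {A : Set} (p : A → Bool) {x : A} {xs : List A} → x ∈ xs → T (p x) → x ∈ filterᵇ p xs
  ∈-filterᵇ⁺ p = ∈-filter⁺ (T? ∘ p)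

  ∈-filterᵇ⁻ : {A : Set} (p : A → Bool) {x : A} {xs : List A} → x ∈ filterᵇ p xs → x ∈ xs × T (p x)
  ∈-filterᵇ⁻ p = ∈-filter⁻ (T? ∘ p)

  filterᵇ-unique : {A : Set} (p : A → Bool) {xs : List A} → Unique xs → Unique (filterᵇ p xs)
  filterᵇ-unique p = filter⁺ (T? ∘ p)

  map-unique : {A B : Set} (f : A → B) {xs : List A} → Unique xs →
    (∀ x y → x ∈ xs → y ∈ xs → f x ≡ f y → x ≡ y) → Unique (map f xs)
  map-unique f {[]}     []       inj = []
  map-unique f {x ∷ xs} (x∉ ∷ u) inj =
    distinct xs x∉ (λ y y∈ → inj x y (here refl) (there y∈))
    ∷ map-unique f u (λ a b a∈ b∈ → inj a b (there a∈) (there b∈))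
    where
    distinct : ∀ ys → All (x ≢_) ys → (∀ y → y ∈ ys → f x ≡ f y → x ≡ y) → All (f x ≢_) (map f ys)
    distinct []       _          _ = []
    distinct (y ∷ ys) (x≢y ∷ ps) h =
      (λ e → x≢y (h y (here refl) e)) ∷ distinct ys ps (λ z z∈ → h z (there z∈))

  unique-length : {A : Set} {xs ys : List A} → Unique xs → Unique ys →
    (∀ z → z ∈ xs → z ∈ ys) → (∀ z → z ∈ ys → z ∈ xs) → length xs ≡ length ys
  unique-length ux uy xs⊆ys ys⊆xs =
    ↭-length (∼bag⇒↭ (unique∧set⇒bag ux uy (λ {z} → mk⇔ (xs⊆ys z) (ys⊆xs z))))

  -- Words

  Letter : ℕ → ℕ → Set
  Letter n x = 1 ≤ x × x ≤ n

  IsWord : ℕ → ℕ → List ℕ → Set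
  IsWord n L w = length w ≡ L × All (Letter n) w

  words-suc : ∀ n L → words n (suc L) ≡ cartesianProductWith (λ w a → suc a ∷ w) (words n L) (upTo n)
  words-suc n L = concat-map (words n L)
    where
    concat-map : ∀ ws → concat (map (λ w → map (λ a → suc a ∷ w) (upTo n)) ws)
                        ≡ cartesianProductWith (λ w a → suc a ∷ w) ws (upTo n)
    concat-map []       = refl
    concat-map (w ∷ ws) = cong (map (λ a → suc a ∷ w) (upTo n) ++_) (concat-map ws)

  words-unique : ∀ n L → Unique (words n L)
  words-unique n zero    = [] ∷ []
  words-unique n (suc L) rewrite words-suc n L =
    cartesianProductWith⁺ _ prepend-injective (words-unique n L) (upTo⁺ n)
    where
    prepend-injective : ∀ {w w′ a a′} → suc a ∷ w ≡ suc a′ ∷ w′ → w ≡ w′ × a ≡ a′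
    prepend-injective refl = refl , refl

  ∈-words⁻ : ∀ n L {w} → w ∈ words n L → IsWord n L w
  ∈-words⁻ n zero    (here refl) = refl , []
  ∈-words⁻ n (suc L) w∈ rewrite words-suc n L
    with ∈-cartesianProductWith⁻ _ (words n L) (upTo n) w∈
  ... | w′ , a , w′∈ , a∈ , refl with ∈-words⁻ n L w′∈
  ... | len , letters = cong suc len , (s≤s z≤n , ∈-upTo⁻ a∈) ∷ letters

  ∈-words⁺ : ∀ n L {w} → IsWord n L w → w ∈ words n L
  ∈-words⁺ n zero    {[]}        (refl , _) = here refl
  ∈-words⁺ n (suc L) {suc a ∷ w} (len , (_ , a≤n) ∷ letters) rewrite words-suc n L =
    ∈-cartesianProductWith⁺ _ (∈-words⁺ n L (suc-injective len , letters)) (∈-upTo⁺ a≤n)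

  -- The Stirling condition

  Stirling : List ℕ → Set
  Stirling w = ∀ a s b → a < s → s < b → b < length w → at w a ≡ at w b → at w a ≤ at w s

  isStirling⇒Stirling : ∀ w → T (isStirling w) → Stirling w
  isStirling⇒Stirling w t a s b a<s s<b b<L eq =
    ≤ᵇ⇒≤ _ _ (if-true (T-∧⁺ (<⇒<ᵇ a<s) (T-∧⁺ (<⇒<ᵇ s<b) (≡⇒≡ᵇ _ _ eq)))
                      (lookup (lookup (lookup t b<L) s<L) a<L))
    where
    s<L = <-trans s<b b<L
    a<L = <-trans a<s s<L
    lookup : ∀ {f : ℕ → Bool} {i} → T (and (map f (upTo (length w)))) → i < length w → T (f i)
    lookup {f} t i< = All.lookup (all⁺ f _ t) (∈-upTo⁺ i<)
    if-true : ∀ {c d} → T c → T (if c then d else true) → T d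
    if-true {true} _ td = td

  Stirling⇒isStirling : ∀ w → Stirling w → T (isStirling w)
  Stirling⇒isStirling w st =
    tabulate λ {b} b< → tabulate λ {s} _ → tabulate λ {a} _ → if-intro λ c →
      let a<s , rest = T-∧⁻ c ; s<b , eq = T-∧⁻ rest
      in ≤⇒≤ᵇ (st a s b (<ᵇ⇒< a s a<s) (<ᵇ⇒< s b s<b) b< (≡ᵇ⇒≡ _ _ eq))
    where
    tabulate : ∀ {f : ℕ → Bool} → (∀ {i} → i < length w → T (f i)) → T (and (map f (upTo (length w))))
    tabulate {f} h = all⁻ f (All.tabulate (λ i∈ → h (∈-upTo⁻ i∈)))
    if-intro : ∀ {c d} → (T c → T d) → T (if c then d else true)
    if-intro {true}  h = h tt
    if-intro {false} h = tt

  LargeBefore : ℕ → List ℕ → Set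
  LargeBefore x []      = ⊤
  LargeBefore x (y ∷ r) = (x ∈ r → x ≤ y) × LargeBefore x r

  Stirling′ : List ℕ → Set
  Stirling′ []      = ⊤
  Stirling′ (x ∷ r) = LargeBefore x r × Stirling′ r

  at-∈ : ∀ r {i} → i < length r → at r i ∈ r
  at-∈ (y ∷ r) {zero}  _        = here refl
  at-∈ (y ∷ r) {suc i} (s≤s i<) = there (at-∈ r i<)

  ∈⇒at : ∀ {x} r → x ∈ r → ∃ λ i → i < length r × at r i ≡ x
  ∈⇒at (y ∷ r) (here refl) = 0 , s≤s z≤n , refl
  ∈⇒at (y ∷ r) (there x∈) with ∈⇒at r x∈
  ... | i , i< , e = suc i , s≤s i< , e

  LargeBefore⁺ : ∀ x r → (∀ s b → s < b → b < length r → at r b ≡ x → x ≤ at r s) → LargeBefore x r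
  LargeBefore⁺ x []      h = tt
  LargeBefore⁺ x (y ∷ r) h =
    (λ x∈ → let i , i< , e = ∈⇒at r x∈ in h 0 (suc i) (s≤s z≤n) (s≤s i<) e) ,
    LargeBefore⁺ x r (λ s b s<b b< e → h (suc s) (suc b) (s≤s s<b) (s≤s b<) e)

  LargeBefore⁻ : ∀ x r → LargeBefore x r → ∀ s b → s < b → b < length r → at r b ≡ x → x ≤ at r s
  LargeBefore⁻ x (y ∷ r) (x∈⇒ , _) zero    (suc b) _          (s≤s b<) e = x∈⇒ (subst (_∈ r) e (at-∈ r b<))
  LargeBefore⁻ x (y ∷ r) (_ , lb)  (suc s) (suc b) (s≤s s<b) (s≤s b<) e = LargeBefore⁻ x r lb s b s<b b< e

  Stirling⇒Stirling′ : ∀ w → Stirling w → Stirling′ w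
  Stirling⇒Stirling′ []      _ = tt
  Stirling⇒Stirling′ (x ∷ r) h =
    LargeBefore⁺ x r (λ s b s<b b< e → h 0 (suc s) (suc b) (s≤s z≤n) (s≤s s<b) (s≤s b<) (sym e)) ,
    Stirling⇒Stirling′ r (λ a s b a<s s<b b< e → h (suc a) (suc s) (suc b) (s≤s a<s) (s≤s s<b) (s≤s b<) e)

  Stirling′⇒Stirling : ∀ w → Stirling′ w → Stirling w
  Stirling′⇒Stirling (x ∷ r) (lb , _) zero    (suc s) (suc b) _          (s≤s s<b) (s≤s b<) e =
    LargeBefore⁻ x r lb s b s<b b< (sym e)
  Stirling′⇒Stirling (x ∷ r) (_ , st) (suc a) (suc s) (suc b) (s≤s a<s) (s≤s s<b) (s≤s b<) e =
    Stirling′⇒Stirling r st a s b a<s s<b b< e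

  isStirling⇒Stirling′ : ∀ w → T (isStirling w) → Stirling′ w
  isStirling⇒Stirling′ w = Stirling⇒Stirling′ w ∘ isStirling⇒Stirling w

  Stirling′⇒isStirling : ∀ w → Stirling′ w → T (isStirling w)
  Stirling′⇒isStirling w = Stirling⇒isStirling w ∘ Stirling′⇒Stirling w

  -- Blocks of the largest letter

  ∈-block⁻ : ∀ {x N : ℕ} c (u v : List ℕ) → x ≢ N → x ∈ u ++ replicate c N ++ v → x ∈ u ++ v
  ∈-block⁻ zero    [] v x≢N x∈          = x∈
  ∈-block⁻ (suc c) [] v x≢N (here x≡N) = ⊥-elim (x≢N x≡N)
  ∈-block⁻ (suc c) [] v x≢N (there x∈) = ∈-block⁻ c [] v x≢N x∈
  ∈-block⁻ c (y ∷ u) v x≢N (here x≡y)  = here x≡y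
  ∈-block⁻ c (y ∷ u) v x≢N (there x∈)  = there (∈-block⁻ c u v x≢N x∈)

  ∈-block⁺ : ∀ {x N : ℕ} c (u v : List ℕ) → x ∈ u ++ v → x ∈ u ++ replicate c N ++ v
  ∈-block⁺ {N = N} c [] v x∈ = ∈-++⁺ʳ (replicate c N) x∈
  ∈-block⁺ c (y ∷ u) v (here x≡y) = here x≡y
  ∈-block⁺ c (y ∷ u) v (there x∈) = there (∈-block⁺ c u v x∈)

  LargeBefore-++ʳ : ∀ x c N v → LargeBefore x (replicate c N ++ v) → LargeBefore x v
  LargeBefore-++ʳ x zero    N v lb       = lb
  LargeBefore-++ʳ x (suc c) N v (_ , lb) = LargeBefore-++ʳ x c N v lb

  LargeBefore-max : ∀ N v → All (_< N) v → LargeBefore N v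
  LargeBefore-max N []      _          = tt
  LargeBefore-max N (y ∷ v) (_ ∷ v<N) =
    (λ N∈v → ⊥-elim (<-irrefl refl (All.lookup v<N N∈v))) , LargeBefore-max N v v<N

  LargeBefore-replicate : ∀ N c v → All (_< N) v → LargeBefore N (replicate c N ++ v)
  LargeBefore-replicate N zero    v v<N = LargeBefore-max N v v<N
  LargeBefore-replicate N (suc c) v v<N = (λ _ → ≤-refl) , LargeBefore-replicate N c v v<N

  LargeBefore-block⁻ : ∀ x N c (u v : List ℕ) → x < N →
    LargeBefore x (u ++ replicate c N ++ v) → LargeBefore x (u ++ v)
  LargeBefore-block⁻ x N c []      v x<N lb        = LargeBefore-++ʳ x c N v lb
  LargeBefore-block⁻ x N c (y ∷ u) v x<N (hy , lb) =
    (λ x∈ → hy (∈-block⁺ c u v x∈)) , LargeBefore-block⁻ x N c u v x<N lb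

  LargeBefore-block⁺ : ∀ x N c (u v : List ℕ) → x < N →
    LargeBefore x (u ++ v) → LargeBefore x (u ++ replicate c N ++ v)
  LargeBefore-block⁺ x N zero    []      v x<N lb        = lb
  LargeBefore-block⁺ x N (suc c) []      v x<N lb        = (λ _ → <⇒≤ x<N) , LargeBefore-block⁺ x N c [] v x<N lb
  LargeBefore-block⁺ x N c       (y ∷ u) v x<N (hy , lb) =
    (λ x∈ → hy (∈-block⁻ c u v (<⇒≢ x<N) x∈)) , LargeBefore-block⁺ x N c u v x<N lb

  Stirling′-block⁻ : ∀ N c (u v : List ℕ) → All (_< N) u →
    Stirling′ (u ++ replicate c N ++ v) → Stirling′ (u ++ v)
  Stirling′-block⁻ N zero    []      v _           st         = st
  Stirling′-block⁻ N (suc c) []      v _           (_ , st)   = Stirling′-block⁻ N c [] v [] st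
  Stirling′-block⁻ N c       (y ∷ u) v (y<N ∷ u<N) (lb , st) =
    LargeBefore-block⁻ y N c u v y<N lb , Stirling′-block⁻ N c u v u<N st

  Stirling′-block⁺ : ∀ N c (u v : List ℕ) → All (_< N) u → All (_< N) v →
    Stirling′ (u ++ v) → Stirling′ (u ++ replicate c N ++ v)
  Stirling′-block⁺ N zero    []      v _           v<N st        = st
  Stirling′-block⁺ N (suc c) []      v _           v<N st        =
    LargeBefore-replicate N c v v<N , Stirling′-block⁺ N c [] v [] v<N st
  Stirling′-block⁺ N c       (y ∷ u) v (y<N ∷ u<N) v<N (lb , st) =
    LargeBefore-block⁺ y N c u v y<N lb , Stirling′-block⁺ N c u v u<N v<N st

  -- Descents

  des : List ℕ → ℕ
  des []          = 0
  des (x ∷ [])    = 1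
  des (x ∷ y ∷ r) = ⟦ y <ᵇ x ⟧ + des (y ∷ r)

  descents-∷∷ : ∀ x y r → descents (x ∷ y ∷ r) ≡ ⟦ y <ᵇ x ⟧ + descents (y ∷ r)
  descents-∷∷ x y r = begin
    descents (x ∷ y ∷ r)
      ≡⟨ length-filterᵇ (isDescent (x ∷ y ∷ r)) (upTo (suc (suc (length r)))) ⟩
    ∑< (suc (suc (length r))) (⟦_⟧ ∘ isDescent (x ∷ y ∷ r))
      ≡⟨ ∑<-suc (suc (length r)) (⟦_⟧ ∘ isDescent (x ∷ y ∷ r)) ⟩
    ⟦ (y <ᵇ x) ∨ false ⟧ + ∑< (suc (length r)) (⟦_⟧ ∘ isDescent (y ∷ r))
      ≡⟨ cong (λ b → ⟦ b ⟧ + ∑< (suc (length r)) (⟦_⟧ ∘ isDescent (y ∷ r))) (∨-identityʳ (y <ᵇ x)) ⟩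
    ⟦ y <ᵇ x ⟧ + ∑< (suc (length r)) (⟦_⟧ ∘ isDescent (y ∷ r))
      ≡⟨ cong (⟦ y <ᵇ x ⟧ +_) (sym (length-filterᵇ (isDescent (y ∷ r)) (upTo (suc (length r))))) ⟩
    ⟦ y <ᵇ x ⟧ + descents (y ∷ r)
      ∎
    where
    open ≡-Reasoning
    isDescent : List ℕ → ℕ → Bool
    isDescent w p = ((suc p <ᵇ length w) ∧ (at w (suc p) <ᵇ at w p)) ∨ (suc p ≡ᵇ length w)

  descents≡des : ∀ w → descents w ≡ des w
  descents≡des []          = refl
  descents≡des (x ∷ [])    = refl
  descents≡des (x ∷ y ∷ r) = trans (descents-∷∷ x y r) (cong (⟦ y <ᵇ x ⟧ +_) (descents≡des (y ∷ r)))

  des-∷-nonzero : ∀ x r → (des (x ∷ r) ≡ᵇ 0) ≡ false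
  des-∷-nonzero x []      = refl
  des-∷-nonzero x (y ∷ r) with y <ᵇ x
  ... | true  = refl
  ... | false = des-∷-nonzero y r

  -- Insertion of a block

  insertBlock : ℕ → ℕ → ℕ → List ℕ → List ℕ
  insertBlock N c zero    w       = replicate c N ++ w
  insertBlock N c (suc p) []      = replicate c N
  insertBlock N c (suc p) (x ∷ w) = x ∷ insertBlock N c p w

  insertBlock-split : ∀ N c p w → p ≤ length w →
    ∃ λ u → ∃ λ v → w ≡ u ++ v × insertBlock N c p w ≡ u ++ replicate c N ++ v
  insertBlock-split N c zero    w       _        = [] , w , refl , refl
  insertBlock-split N c (suc p) (x ∷ w) (s≤s p≤) with insertBlock-split N c p w p≤
  ... | u , v , w≡ , ins≡ = x ∷ u , v , cong (x ∷_) w≡ , cong (x ∷_) ins≡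

  insertBlock-length : ∀ N c u v → insertBlock N c (length u) (u ++ v) ≡ u ++ replicate c N ++ v
  insertBlock-length N c []      v = refl
  insertBlock-length N c (x ∷ u) v = cong (x ∷_) (insertBlock-length N c u v)

  insertBlock-injective : ∀ N c → 1 ≤ c → ∀ p₁ p₂ w₁ w₂ → All (_< N) w₁ → All (_< N) w₂ →
    p₁ ≤ length w₁ → p₂ ≤ length w₂ →
    insertBlock N c p₁ w₁ ≡ insertBlock N c p₂ w₂ → p₁ ≡ p₂ × w₁ ≡ w₂
  insertBlock-injective N c _ zero zero w₁ w₂ _ _ _ _ e = refl , ++-cancelˡ (replicate c N) w₁ w₂ e
  insertBlock-injective N (suc c) _ zero (suc p₂) w₁ (x ∷ w₂) _ (x<N ∷ _) _ _ e =
    ⊥-elim (<-irrefl (sym (∷-injectiveˡ e)) x<N)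
  insertBlock-injective N (suc c) _ (suc p₁) zero (x ∷ w₁) w₂ (x<N ∷ _) _ _ _ e =
    ⊥-elim (<-irrefl (∷-injectiveˡ e) x<N)
  insertBlock-injective N c c≥1 (suc p₁) (suc p₂) (x ∷ w₁) (y ∷ w₂)
                        (_ ∷ w₁<N) (_ ∷ w₂<N) (s≤s p₁≤) (s≤s p₂≤) e
    with ∷-injective e
  ... | refl , e′ with insertBlock-injective N c c≥1 p₁ p₂ w₁ w₂ w₁<N w₂<N p₁≤ p₂≤ e′
  ... | refl , refl = refl , refl

  NoHead : ℕ → List ℕ → Set
  NoHead N []      = ⊤
  NoHead N (y ∷ _) = y ≢ N

  splitLeading : ∀ N z → ∃ λ a → ∃ λ v → z ≡ replicate a N ++ v × NoHead N v
  splitLeading N []      = 0 , [] , refl , tt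
  splitLeading N (y ∷ z) with y ≟ N
  ... | no y≢N = 0 , y ∷ z , refl , y≢N
  ... | yes refl with splitLeading N z
  ...   | a , v , z≡ , nh = suc a , v , cong (y ∷_) z≡ , nh

  Stirling′-block-decomposition : ∀ N z → Stirling′ z → All (_≤ N) z →
    ∃ λ u → ∃ λ a → ∃ λ v → z ≡ u ++ replicate a N ++ v × All (_< N) u × All (_< N) v
  Stirling′-block-decomposition N []      _        _ = [] , 0 , [] , refl , [] , []
  Stirling′-block-decomposition N (x ∷ z) (lb , st) (x≤N ∷ z≤N) with x ≟ N
  ... | no x≢N with Stirling′-block-decomposition N z st z≤N
  ...   | u , a , v , z≡ , u<N , v<N = x ∷ u , a , v , cong (x ∷_) z≡ , ≤∧≢⇒< x≤N x≢N ∷ u<N , v<N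
  Stirling′-block-decomposition N (x ∷ z) (lb , st) (x≤N ∷ z≤N) | yes refl with splitLeading x z
  ... | a , []    , refl , _   = [] , suc a , [] , refl , [] , []
  ... | a , y ∷ v , refl , y≢N with ++⁻ʳ (replicate a x) z≤N
  ...   | y≤N ∷ v≤N = [] , suc a , y ∷ v , refl , [] , y<N ∷ All.tabulate below
    where
    y<N : y < x
    y<N = ≤∧≢⇒< y≤N y≢N
    below : ∀ {t} → t ∈ v → t < x
    below {t} t∈ with t ≟ x
    ... | yes refl = ⊥-elim (<⇒≱ y<N (proj₁ (LargeBefore-++ʳ x a x (y ∷ v) lb) t∈))
    ... | no t≢N  = ≤∧≢⇒< (All.lookup v≤N t∈) t≢N

  descentAt : ℕ → List ℕ → ℕ
  descentAt zero          _           = 0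
  descentAt (suc p)       []          = 0
  descentAt (suc zero)    (x ∷ [])    = 1
  descentAt (suc zero)    (x ∷ y ∷ r) = ⟦ y <ᵇ x ⟧
  descentAt (suc (suc p)) (x ∷ w)     = descentAt (suc p) w

  descentAt≤1 : ∀ p w → descentAt p w ≤ 1
  descentAt≤1 zero          w           = z≤n
  descentAt≤1 (suc p)       []          = z≤n
  descentAt≤1 (suc zero)    (x ∷ [])    = ≤-refl
  descentAt≤1 (suc zero)    (x ∷ y ∷ r) with y <ᵇ x
  ... | true  = ≤-refl
  ... | false = z≤n
  descentAt≤1 (suc (suc p)) (x ∷ w)     = descentAt≤1 (suc p) w

  ∑-descentAt : ∀ w → ∑< (suc (length w)) (λ p → descentAt p w) ≡ des w
  ∑-descentAt w = trans (∑<-suc (length w) (λ p → descentAt p w)) (∑-descentAt-suc w)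
    where
    ∑-descentAt-suc : ∀ w → ∑< (length w) (λ p → descentAt (suc p) w) ≡ des w
    ∑-descentAt-suc []          = refl
    ∑-descentAt-suc (x ∷ [])    = refl
    ∑-descentAt-suc (x ∷ y ∷ r) =
      trans (∑<-suc (suc (length r)) (λ p → descentAt (suc p) (x ∷ y ∷ r)))
            (cong (⟦ y <ᵇ x ⟧ +_) (∑-descentAt-suc (y ∷ r)))

  des-replicate : ∀ N c v → des (N ∷ replicate c N ++ v) ≡ des (N ∷ v)
  des-replicate N zero    v = refl
  des-replicate N (suc c) v rewrite <ᵇ-false (≤-refl {N}) = des-replicate N c v

  des-∷-max : ∀ N v → All (_< N) v → des (N ∷ v) ≡ suc (des v)
  des-∷-max N []      _         = refl
  des-∷-max N (y ∷ r) (y<N ∷ _) rewrite <ᵇ-true y<N = refl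

  -- The block ends in a new descent, and it replaces the descent at the p-th letter (descentAt p w), if any.
  des-insertBlock : ∀ N c → 1 ≤ c → ∀ p w → All (_< N) w → p ≤ length w →
    des (insertBlock N c p w) + descentAt p w ≡ suc (des w)
  des-insertBlock N (suc c) _ zero w w<N _ =
    trans (+-identityʳ _) (trans (des-replicate N c w) (des-∷-max N w w<N))
  des-insertBlock N (suc c) _ (suc zero) (x ∷ []) (x<N ∷ _) _
    rewrite <ᵇ-false (<⇒≤ x<N) | des-replicate N c [] = refl
  des-insertBlock N (suc c) _ (suc zero) (x ∷ y ∷ r) (x<N ∷ r<N) _
    rewrite <ᵇ-false (<⇒≤ x<N) | des-replicate N c (y ∷ r) | des-∷-max N (y ∷ r) r<N =
    cong suc (+-comm (des (y ∷ r)) ⟦ y <ᵇ x ⟧)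
  des-insertBlock N c c≥1 (suc (suc p)) (x ∷ y ∷ w) (_ ∷ w<N) (s≤s p≤) = begin
    ⟦ y <ᵇ x ⟧ + des (insertBlock N c (suc p) (y ∷ w)) + descentAt (suc p) (y ∷ w)
      ≡⟨ +-assoc ⟦ y <ᵇ x ⟧ _ _ ⟩
    ⟦ y <ᵇ x ⟧ + (des (insertBlock N c (suc p) (y ∷ w)) + descentAt (suc p) (y ∷ w))
      ≡⟨ cong (⟦ y <ᵇ x ⟧ +_) (des-insertBlock N c c≥1 (suc p) (y ∷ w) w<N p≤) ⟩
    ⟦ y <ᵇ x ⟧ + suc (des (y ∷ w))
      ≡⟨ +-suc ⟦ y <ᵇ x ⟧ _ ⟩
    suc (⟦ y <ᵇ x ⟧ + des (y ∷ w))
      ∎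
    where open ≡-Reasoning

  ⟦≡ᵇ⟧-*-cong : ∀ a b (f : ℕ → ℕ) → ⟦ a ≡ᵇ b ⟧ * f a ≡ ⟦ a ≡ᵇ b ⟧ * f b
  ⟦≡ᵇ⟧-*-cong a b f with a ≡ᵇ b in eq
  ... | false = refl
  ... | true  rewrite ≡ᵇ⇒≡ a b (≡true⇒T eq) = refl

  des-insertBlock-≡ᵇ : ∀ N c → 1 ≤ c → ∀ w → All (_< N) w → ∀ j p → p ≤ length w →
    ⟦ des (insertBlock N c p w) ≡ᵇ suc j ⟧
      ≡ descentAt p w * ⟦ des w ≡ᵇ suc j ⟧ + (1 ∸ descentAt p w) * ⟦ des w ≡ᵇ j ⟧
  des-insertBlock-≡ᵇ N c c≥1 w w<N j p p≤
    with descentAt p w | des-insertBlock N c c≥1 p w w<N p≤ | descentAt≤1 p w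
  ... | zero     | e | _ rewrite +-identityʳ (des (insertBlock N c p w)) | e = sym (+-identityʳ _)
  ... | suc zero | e | _ rewrite +-comm (des (insertBlock N c p w)) 1 | suc-injective e =
    sym (trans (+-identityʳ _) (+-identityʳ _))
  ... | suc (suc _) | _ | s≤s ()

  -- Of the length w + 1 gaps, des w keep the number of descents and the others raise it by one.
  ∑-insertBlock-des : ∀ N c → 1 ≤ c → ∀ w → All (_< N) w → ∀ j →
    ∑< (suc (length w)) (λ p → ⟦ des (insertBlock N c p w) ≡ᵇ suc j ⟧)
      ≡ ⟦ des w ≡ᵇ suc j ⟧ * suc j + ⟦ des w ≡ᵇ j ⟧ * (suc (length w) ∸ j)
  ∑-insertBlock-des N c c≥1 w w<N j = begin
    ∑< n (λ p → ⟦ des (insertBlock N c p w) ≡ᵇ suc j ⟧)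
      ≡⟨ ∑<-cong n (λ p p< → des-insertBlock-≡ᵇ N c c≥1 w w<N j p (s≤s⁻¹ p<)) ⟩
    ∑< n (λ p → descentAt p w * X + (1 ∸ descentAt p w) * Y)
      ≡⟨ ∑-+ (upTo n) (λ p → descentAt p w * X) (λ p → (1 ∸ descentAt p w) * Y) ⟩
    ∑< n (λ p → descentAt p w * X) + ∑< n (λ p → (1 ∸ descentAt p w) * Y)
      ≡⟨ cong₂ _+_ (∑-*ʳ (upTo n) X (λ p → descentAt p w)) (∑-*ʳ (upTo n) Y (λ p → 1 ∸ descentAt p w)) ⟩
    ∑< n (λ p → descentAt p w) * X + ∑< n (λ p → 1 ∸ descentAt p w) * Y
      ≡⟨ cong₂ (λ a b → a * X + b * Y) (∑-descentAt w) non-descents ⟩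
    des w * X + (n ∸ des w) * Y
      ≡⟨ cong₂ _+_ (*-comm (des w) X) (*-comm (n ∸ des w) Y) ⟩
    X * des w + Y * (n ∸ des w)
      ≡⟨ cong₂ _+_ (⟦≡ᵇ⟧-*-cong (des w) (suc j) id) (⟦≡ᵇ⟧-*-cong (des w) j (n ∸_)) ⟩
    X * suc j + Y * (n ∸ j)
      ∎
    where
    open ≡-Reasoning
    n = suc (length w)
    X = ⟦ des w ≡ᵇ suc j ⟧
    Y = ⟦ des w ≡ᵇ j ⟧
    all-positions : ∑< n (λ p → 1 ∸ descentAt p w) + ∑< n (λ p → descentAt p w) ≡ n
    all-positions = begin
      ∑< n (λ p → 1 ∸ descentAt p w) + ∑< n (λ p → descentAt p w)
        ≡⟨ sym (∑-+ (upTo n) (λ p → 1 ∸ descentAt p w) (λ p → descentAt p w)) ⟩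
      ∑< n (λ p → 1 ∸ descentAt p w + descentAt p w)
        ≡⟨ ∑<-cong n (λ p _ → m∸n+n≡m (descentAt≤1 p w)) ⟩
      ∑< n (λ _ → 1)
        ≡⟨ ∑<-const-1 n ⟩
      n ∎
    non-descents : ∑< n (λ p → 1 ∸ descentAt p w) ≡ n ∸ des w
    non-descents = trans (sym (m+n∸n≡m _ (∑< n (λ p → descentAt p w))))
                         (cong₂ _∸_ all-positions (∑-descentAt w))

  length-block : ∀ (u v : List ℕ) c N → length (u ++ replicate c N ++ v) ≡ length u + length v + c
  length-block u v c N rewrite length-++ u {replicate c N ++ v} | length-++ (replicate c N) {v} | length-replicate c {N} =
    trans (cong (length u +_) (+-comm c (length v))) (sym (+-assoc (length u) (length v) c))

  -- Multiplicities

  occ-++ : ∀ a xs ys → occ a (xs ++ ys) ≡ occ a xs + occ a ys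
  occ-++ a []       ys = refl
  occ-++ a (x ∷ xs) ys with a ≡ᵇ x
  ... | true  = cong suc (occ-++ a xs ys)
  ... | false = occ-++ a xs ys

  occ-replicate : ∀ N c → occ N (replicate c N) ≡ c
  occ-replicate N zero    = refl
  occ-replicate N (suc c) rewrite ≡ᵇ-refl N = cong suc (occ-replicate N c)

  occ-replicate-≢ : ∀ a N c → a ≢ N → occ a (replicate c N) ≡ 0
  occ-replicate-≢ a N zero    a≢N = refl
  occ-replicate-≢ a N (suc c) a≢N rewrite ≡ᵇ-false a≢N = occ-replicate-≢ a N c a≢N

  occ-max : ∀ N xs → All (_< N) xs → occ N xs ≡ 0
  occ-max N []       _           = refl
  occ-max N (x ∷ xs) (x<N ∷ xs<N) rewrite ≡ᵇ-false (>⇒≢ x<N) = occ-max N xs xs<N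

  occ-block-≢ : ∀ a N c u v → a ≢ N → occ a (u ++ replicate c N ++ v) ≡ occ a (u ++ v)
  occ-block-≢ a N c u v a≢N
    rewrite occ-++ a u (replicate c N ++ v) | occ-++ a (replicate c N) v
          | occ-replicate-≢ a N c a≢N | occ-++ a u v = refl

  occ-block : ∀ N c u v → All (_< N) u → All (_< N) v → occ N (u ++ replicate c N ++ v) ≡ c
  occ-block N c u v u<N v<N
    rewrite occ-++ N u (replicate c N ++ v) | occ-++ N (replicate c N) v
          | occ-replicate N c | occ-max N u u<N | occ-max N v v<N = +-identityʳ c

  multFrom-cong : ∀ j cs w w′ → (∀ a → j < a → a ≤ j + length cs → occ a w ≡ occ a w′) →
    multFrom j cs w ≡ multFrom j cs w′
  multFrom-cong j []       w w′ h = refl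
  multFrom-cong j (c ∷ cs) w w′ h =
    cong₂ _∧_ (cong (_≡ᵇ c) (h (suc j) ≤-refl (subst (suc j ≤_) (sym (+-suc j (length cs))) (s≤s (m≤m+n j _)))))
              (multFrom-cong (suc j) cs w w′ λ a j< a≤ → h a (<-trans (n<1+n j) j<) (subst (a ≤_) (sym (+-suc j _)) a≤))

  multFrom-++ : ∀ j cs ds w → multFrom j (cs ++ ds) w ≡ multFrom j cs w ∧ multFrom (j + length cs) ds w
  multFrom-++ j []       ds w = cong (λ i → multFrom i ds w) (sym (+-identityʳ j))
  multFrom-++ j (c ∷ cs) ds w = begin
    (occ (suc j) w ≡ᵇ c) ∧ multFrom (suc j) (cs ++ ds) w
      ≡⟨ cong ((occ (suc j) w ≡ᵇ c) ∧_) (multFrom-++ (suc j) cs ds w) ⟩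
    (occ (suc j) w ≡ᵇ c) ∧ (multFrom (suc j) cs w ∧ multFrom (suc j + length cs) ds w)
      ≡⟨ cong (λ i → (occ (suc j) w ≡ᵇ c) ∧ (multFrom (suc j) cs w ∧ multFrom i ds w)) (sym (+-suc j (length cs))) ⟩
    (occ (suc j) w ≡ᵇ c) ∧ (multFrom (suc j) cs w ∧ multFrom (j + suc (length cs)) ds w)
      ≡⟨ sym (∧-assoc (occ (suc j) w ≡ᵇ c) _ _) ⟩
    ((occ (suc j) w ≡ᵇ c) ∧ multFrom (suc j) cs w) ∧ multFrom (j + suc (length cs)) ds w
      ∎
    where open ≡-Reasoning

  hasMultiplicities-∷ʳ : ∀ {m} (ks : Vec ℕ m) c w →
    hasMultiplicities (ks ∷ʳ c) w ≡ hasMultiplicities ks w ∧ (occ (suc m) w ≡ᵇ c)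
  hasMultiplicities-∷ʳ {m} ks c w
    rewrite toList-∷ʳ c ks | multFrom-++ 0 (Vec.toList ks) (c ∷ []) w | length-toList ks =
    cong (hasMultiplicities ks w ∧_) (∧-identityʳ _)

  hasMultiplicities-block : ∀ {m} (ks : Vec ℕ m) c u v →
    hasMultiplicities ks (u ++ replicate c (suc m) ++ v) ≡ hasMultiplicities ks (u ++ v)
  hasMultiplicities-block {m} ks c u v =
    multFrom-cong 0 (Vec.toList ks) _ _
      λ a _ a≤ → occ-block-≢ a (suc m) c u v λ a≡ → <-irrefl a≡ (s≤s (subst (a ≤_) (length-toList ks) a≤))

  total-∷ʳ : ∀ {m} (ks : Vec ℕ m) c → total (ks ∷ʳ c) ≡ total ks + c
  total-∷ʳ []        c = +-identityʳ c
  total-∷ʳ (k ∷ ks)  c = trans (cong (k +_) (total-∷ʳ ks c)) (sym (+-assoc k _ c))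

  module Insertion (m : ℕ) (ks : Vec ℕ m) (c : ℕ) (c≥1 : 1 ≤ c) where

    N  = suc m
    K′ = total ks
    k  = ks ∷ʳ c

    isPerm′ : List ℕ → Bool
    isPerm′ w = hasMultiplicities ks w ∧ isStirling w

    perms′ : List (List ℕ)
    perms′ = filterᵇ isPerm′ (words m K′)

    pairs : List (List ℕ × ℕ)
    pairs = cartesianProduct perms′ (upTo (suc K′))

    insert : List ℕ × ℕ → List ℕ
    insert (w , p) = insertBlock N c p w

    hasDescents : ℕ → List ℕ → Bool
    hasDescents i w = descents w ≡ᵇ i

    isPerm : ℕ → List ℕ → Bool
    isPerm i w = hasMultiplicities k w ∧ isStirling w ∧ hasDescents i w

    perms : ℕ → List (List ℕ)
    perms i = filterᵇ (isPerm i) (words N (total k))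

    insertions : ℕ → List (List ℕ)
    insertions i = filterᵇ (hasDescents i) (map insert pairs)

    total-k : total k ≡ K′ + c
    total-k = total-∷ʳ ks c

    Letter⇒< : ∀ {x} → Letter m x → x < N
    Letter⇒< (_ , x≤m) = s≤s x≤m

    Letter-suc : ∀ {x} → Letter m x → Letter N x
    Letter-suc (1≤x , x≤m) = 1≤x , m≤n⇒m≤1+n x≤m

    Letter-pred : ∀ {x} → Letter N x → x < N → Letter m x
    Letter-pred (1≤x , _) x<N = 1≤x , s≤s⁻¹ x<N

    ∈perms′⁻ : ∀ {w} → w ∈ perms′ → IsWord m K′ w × T (hasMultiplicities ks w) × Stirling′ w
    ∈perms′⁻ {w} w∈ with ∈-filterᵇ⁻ isPerm′ w∈
    ... | w∈words , t with T-∧⁻ t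
    ...   | hm , st = ∈-words⁻ m K′ w∈words , hm , isStirling⇒Stirling′ w st

    ∈pairs⁻ : ∀ {w p} → (w , p) ∈ pairs → w ∈ perms′ × p ≤ length w
    ∈pairs⁻ {w} q∈ with ∈-cartesianProduct⁻ perms′ (upTo (suc K′)) q∈
    ... | w∈ , p∈ = w∈ , subst (_ ≤_) (sym (proj₁ (proj₁ (∈perms′⁻ w∈)))) (s≤s⁻¹ (∈-upTo⁻ p∈))

    ∈perms′⇒< : ∀ {w} → w ∈ perms′ → All (_< N) w
    ∈perms′⇒< w∈ = All.map Letter⇒< (proj₂ (proj₁ (∈perms′⁻ w∈)))

    insert-injective : ∀ q₁ q₂ → q₁ ∈ pairs → q₂ ∈ pairs → insert q₁ ≡ insert q₂ → q₁ ≡ q₂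
    insert-injective (w₁ , p₁) (w₂ , p₂) q₁∈ q₂∈ e
      with ∈pairs⁻ q₁∈ | ∈pairs⁻ q₂∈
    ... | w₁∈ , p₁≤ | w₂∈ , p₂≤
      with insertBlock-injective N c c≥1 p₁ p₂ w₁ w₂ (∈perms′⇒< w₁∈) (∈perms′⇒< w₂∈) p₁≤ p₂≤ e
    ... | refl , refl = refl

    perms-unique : ∀ i → Unique (perms i)
    perms-unique i = filterᵇ-unique (isPerm i) (words-unique N (total k))

    insertions-unique : ∀ i → Unique (insertions i)
    insertions-unique i = filterᵇ-unique (hasDescents i)
      (map-unique insert (cartesianProduct⁺ (filterᵇ-unique isPerm′ (words-unique m K′)) (upTo⁺ (suc K′)))
                  insert-injective)

    perms⊆insertions : ∀ i z → z ∈ perms i → z ∈ insertions i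
    perms⊆insertions i z z∈ with ∈-filterᵇ⁻ (isPerm i) z∈
    ... | z∈words , t with T-∧⁻ {hasMultiplicities k z} t | ∈-words⁻ N (total k) z∈words
    ... | hm , t′ | len , letters with T-∧⁻ {isStirling z} t′
    ... | st , des≡i
      with Stirling′-block-decomposition N z (isStirling⇒Stirling′ z st) (All.map proj₂ letters)
    ... | u , a , v , refl , u<N , v<N
      with T-∧⁻ {hasMultiplicities ks (u ++ replicate a N ++ v)} (subst T (hasMultiplicities-∷ʳ ks c _) hm)
    ... | hm′ , occ≡c with trans (sym (occ-block N a u v u<N v<N)) (≡ᵇ⇒≡ (occ N (u ++ replicate a N ++ v)) c occ≡c)
    ... | refl = ∈-filterᵇ⁺ (hasDescents i)
                   (subst (_∈ map insert pairs) (insertBlock-length N c u v)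
                     (∈-map⁺ insert (∈-cartesianProduct⁺ uv∈ (∈-upTo⁺ (s≤s |u|≤K′)))))
                   des≡i
      where
      |u|+|v| : length u + length v ≡ K′
      |u|+|v| = +-cancelʳ-≡ c _ _ (trans (sym (length-block u v c N)) (trans len total-k))
      |u|≤K′ : length u ≤ K′
      |u|≤K′ = subst (length u ≤_) |u|+|v| (m≤m+n (length u) (length v))
      uv-letters : All (Letter m) (u ++ v)
      uv-letters = ++⁺ (All.zipWith (λ (l , x<N) → Letter-pred l x<N) (++⁻ˡ u letters , u<N))
                       (All.zipWith (λ (l , x<N) → Letter-pred l x<N) (++⁻ʳ (replicate c N) (++⁻ʳ u letters) , v<N))
      uv∈ : (u ++ v) ∈ perms′
      uv∈ = ∈-filterᵇ⁺ isPerm′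
        (∈-words⁺ m K′ (trans (length-++ u) |u|+|v| , uv-letters))
        (T-∧⁺ {hasMultiplicities ks (u ++ v)} (subst T (hasMultiplicities-block ks c u v) hm′)
              (Stirling′⇒isStirling (u ++ v)
                (Stirling′-block⁻ N c u v u<N (isStirling⇒Stirling′ (u ++ replicate c N ++ v) st))))

    insertions⊆perms : ∀ i z → z ∈ insertions i → z ∈ perms i
    insertions⊆perms i z z∈ with ∈-filterᵇ⁻ (hasDescents i) z∈
    ... | z∈map , des≡i with ∈-map⁻ insert z∈map
    ... | (w , p) , q∈ , refl with ∈pairs⁻ q∈
    ... | w∈ , p≤ with ∈perms′⁻ w∈ | insertBlock-split N c p w p≤
    ... | (len , letters) , hm , st | u , v , refl , ins≡ rewrite ins≡ =
      ∈-filterᵇ⁺ (isPerm i) (∈-words⁺ N (total k) (z-length , z-letters))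
        (T-∧⁺ {hasMultiplicities k z′} z-hm (T-∧⁺ {isStirling z′} z-st des≡i))
      where
      z′ = u ++ replicate c N ++ v
      u<N = ++⁻ˡ u (∈perms′⇒< w∈)
      v<N = ++⁻ʳ u (∈perms′⇒< w∈)
      z-length : length z′ ≡ total k
      z-length = trans (length-block u v c N) (trans (cong (_+ c) (trans (sym (length-++ u)) len)) (sym total-k))
      z-letters : All (Letter N) z′
      z-letters = ++⁺ (All.map Letter-suc (++⁻ˡ u letters))
                      (++⁺ (replicate⁺ c (s≤s z≤n , ≤-refl)) (All.map Letter-suc (++⁻ʳ u letters)))
      z-hm : T (hasMultiplicities k z′)
      z-hm = subst T (sym (hasMultiplicities-∷ʳ ks c z′))
               (T-∧⁺ (subst T (sym (hasMultiplicities-block ks c u v)) hm)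
                     (subst (λ o → T (o ≡ᵇ c)) (sym (occ-block N c u v u<N v<N)) (≡⇒≡ᵇ c c refl)))
      z-st : T (isStirling z′)
      z-st = Stirling′⇒isStirling z′ (Stirling′-block⁺ N c u v u<N v<N st)

    A-k-as-∑ : ∀ i → A k i ≡ ∑ perms′ (λ w → ∑< (suc K′) (λ p → ⟦ des (insertBlock N c p w) ≡ᵇ i ⟧))
    A-k-as-∑ i = begin
      A k i
        ≡⟨ unique-length (perms-unique i) (insertions-unique i) (perms⊆insertions i) (insertions⊆perms i) ⟩
      length (insertions i)
        ≡⟨ length-filterᵇ (hasDescents i) (map insert pairs) ⟩
      ∑ (map insert pairs) (⟦_⟧ ∘ hasDescents i)
        ≡⟨ ∑-map insert pairs (⟦_⟧ ∘ hasDescents i) ⟩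
      ∑ pairs (⟦_⟧ ∘ hasDescents i ∘ insert)
        ≡⟨ ∑-cartesianProduct perms′ (upTo (suc K′)) (⟦_⟧ ∘ hasDescents i ∘ insert) ⟩
      ∑ perms′ (λ w → ∑< (suc K′) (λ p → ⟦ descents (insertBlock N c p w) ≡ᵇ i ⟧))
        ≡⟨ ∑-cong perms′ (λ w _ → ∑<-cong (suc K′) λ p _ →
             cong (λ d → ⟦ d ≡ᵇ i ⟧) (descents≡des (insertBlock N c p w))) ⟩
      ∑ perms′ (λ w → ∑< (suc K′) (λ p → ⟦ des (insertBlock N c p w) ≡ᵇ i ⟧))
        ∎
      where open ≡-Reasoning

    A-ks-as-∑ : ∀ i → A ks i ≡ ∑ perms′ (λ w → ⟦ des w ≡ᵇ i ⟧)
    A-ks-as-∑ i = begin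
      A ks i
        ≡⟨ length-filterᵇ _ (words m K′) ⟩
      ∑ (words m K′) (λ w → ⟦ hasMultiplicities ks w ∧ (isStirling w ∧ hasDescents i w) ⟧)
        ≡⟨ ∑-⟦∧⟧-filterᵇ (hasMultiplicities ks) isStirling (hasDescents i) (words m K′) ⟩
      ∑ perms′ (⟦_⟧ ∘ hasDescents i)
        ≡⟨ ∑-cong perms′ (λ w _ → cong (λ d → ⟦ d ≡ᵇ i ⟧) (descents≡des w)) ⟩
      ∑ perms′ (λ w → ⟦ des w ≡ᵇ i ⟧)
        ∎
      where open ≡-Reasoning

    A-∷ʳ-suc : ∀ j → A k (suc j) ≡ suc j * A ks (suc j) + (suc K′ ∸ j) * A ks j
    A-∷ʳ-suc j = begin
      A k (suc j)
        ≡⟨ A-k-as-∑ (suc j) ⟩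
      ∑ perms′ (λ w → ∑< (suc K′) (λ p → ⟦ des (insertBlock N c p w) ≡ᵇ suc j ⟧))
        ≡⟨ ∑-cong perms′ insertions-of ⟩
      ∑ perms′ (λ w → X w * suc j + Y w * (suc K′ ∸ j))
        ≡⟨ ∑-+ perms′ (λ w → X w * suc j) (λ w → Y w * (suc K′ ∸ j)) ⟩
      ∑ perms′ (λ w → X w * suc j) + ∑ perms′ (λ w → Y w * (suc K′ ∸ j))
        ≡⟨ cong₂ _+_ (∑-*ʳ perms′ (suc j) X) (∑-*ʳ perms′ (suc K′ ∸ j) Y) ⟩
      ∑ perms′ X * suc j + ∑ perms′ Y * (suc K′ ∸ j)
        ≡⟨ cong₂ (λ a b → a * suc j + b * (suc K′ ∸ j)) (sym (A-ks-as-∑ (suc j))) (sym (A-ks-as-∑ j)) ⟩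
      A ks (suc j) * suc j + A ks j * (suc K′ ∸ j)
        ≡⟨ cong₂ _+_ (*-comm (A ks (suc j)) (suc j)) (*-comm (A ks j) (suc K′ ∸ j)) ⟩
      suc j * A ks (suc j) + (suc K′ ∸ j) * A ks j
        ∎
      where
      open ≡-Reasoning
      X Y : List ℕ → ℕ
      X w = ⟦ des w ≡ᵇ suc j ⟧
      Y w = ⟦ des w ≡ᵇ j ⟧
      insertions-of : ∀ w → w ∈ perms′ →
        ∑< (suc K′) (λ p → ⟦ des (insertBlock N c p w) ≡ᵇ suc j ⟧) ≡ X w * suc j + Y w * (suc K′ ∸ j)
      insertions-of w w∈ rewrite sym (proj₁ (proj₁ (∈perms′⁻ w∈))) =
        ∑-insertBlock-des N c c≥1 w (∈perms′⇒< w∈) j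

  -- The recurrence for an arbitrary composition

  init-∷ʳ-last : ∀ {m} (k : Vec ℕ (suc m)) → k ≡ init k ∷ʳ last k
  init-∷ʳ-last k = proj₂ (proj₂ (Vec.initLast k))

  All-init : ∀ {P : ℕ → Set} {m} (k : Vec ℕ (suc m)) → VecAll.All P k → VecAll.All P (init k)
  All-init {m = zero}  (x ∷ [])  (px ∷ [])  = []
  All-init {m = suc m} (x ∷ xs) (px ∷ pxs) = px ∷ All-init xs pxs

  All-last : ∀ {P : ℕ → Set} {m} (k : Vec ℕ (suc m)) → VecAll.All P k → P (last k)
  All-last {m = zero}  (x ∷ [])  (px ∷ [])  = px
  All-last {m = suc m} (x ∷ xs) (_ ∷ pxs)  = All-last xs pxs

  length≤total : ∀ {n} (k : Vec ℕ n) → VecAll.All (1 ≤_) k → n ≤ total k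
  length≤total []       []         = z≤n
  length≤total (x ∷ k) (1≤x ∷ k⁺) = +-mono-≤ 1≤x (length≤total k k⁺)

  A-suc : ∀ {m} (k : Vec ℕ (suc m)) → 1 ≤ last k → ∀ j →
    A k (suc j) ≡ suc j * A (init k) (suc j) + (suc (total (init k)) ∸ j) * A (init k) j
  A-suc {m} k 1≤last j =
    subst (λ k′ → A k′ (suc j) ≡ suc j * A (init k) (suc j) + (suc (total (init k)) ∸ j) * A (init k) j)
          (sym (init-∷ʳ-last k))
          (Insertion.A-∷ʳ-suc m (init k) (last k) 1≤last j)

  A-singleton : ∀ c → 1 ≤ c → A (c ∷ []) 1 ≡ 1
  A-singleton c 1≤c = A-suc (c ∷ []) 1≤c 0

  A-zero : ∀ {n} (k : Vec ℕ n) → 1 ≤ total k → A k 0 ≡ 0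
  A-zero {n} k 1≤K = trans (length-filterᵇ _ (words n (total k))) (∑-zero (words n (total k)) no-descents)
    where
    no-descents : ∀ w → w ∈ words n (total k) →
      ⟦ hasMultiplicities k w ∧ isStirling w ∧ (descents w ≡ᵇ 0) ⟧ ≡ 0
    no-descents []      w∈ = ⊥-elim (<⇒≢ 1≤K (proj₁ (∈-words⁻ n (total k) w∈)))
    no-descents (x ∷ r) _
      rewrite descents≡des (x ∷ r) | des-∷-nonzero x r
            | ∧-zeroʳ (isStirling (x ∷ r)) | ∧-zeroʳ (hasMultiplicities k (x ∷ r)) = refl

  A-above : ∀ n (k : Vec ℕ n) → VecAll.All (1 ≤_) k → ∀ i → n < i → A k i ≡ 0
  A-above zero    []  _  (suc j) _         = refl
  A-above (suc m) k  k⁺ (suc j) (s≤s m<j) = begin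
    A k (suc j)
      ≡⟨ A-suc k (All-last k k⁺) j ⟩
    suc j * A (init k) (suc j) + (suc (total (init k)) ∸ j) * A (init k) j
      ≡⟨ cong₂ (λ a b → suc j * a + (suc (total (init k)) ∸ j) * b)
               (A-above m (init k) (All-init k k⁺) (suc j) (m<n⇒m<1+n m<j))
               (A-above m (init k) (All-init k k⁺) j m<j) ⟩
    suc j * 0 + (suc (total (init k)) ∸ j) * 0
      ≡⟨ cong₂ _+_ (*-zeroʳ (suc j)) (*-zeroʳ (suc (total (init k)) ∸ j)) ⟩
    0 ∎
    where open ≡-Reasoning

  -- Formal power series

  module ≗-Reasoning = SetoidReasoning (ℕ →-setoid ℕ)

  infixl 6 _⊕_
  infixl 7 _•_

  _⊕_ : Series → Series → Series
  (f ⊕ g) t = f t + g t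

  _•_ : ℕ → Series → Series
  (a • f) t = a * f t

  ⊛-coeff : ∀ f g t → (f ⊛ g) t ≡ ∑< (suc t) (λ j → f j * g (t ∸ j))
  ⊛-coeff f g t = Σ<≡∑< (suc t) (λ j → f j * g (t ∸ j))

  ⊛-cong : ∀ {f f′ g g′} → f ≗ f′ → g ≗ g′ → f ⊛ g ≗ f′ ⊛ g′
  ⊛-cong {f} {f′} {g} {g′} f≗ g≗ t = begin
    (f ⊛ g) t                                ≡⟨ ⊛-coeff f g t ⟩
    ∑< (suc t) (λ j → f j * g (t ∸ j))       ≡⟨ ∑<-cong (suc t) (λ j _ → cong₂ _*_ (f≗ j) (g≗ (t ∸ j))) ⟩
    ∑< (suc t) (λ j → f′ j * g′ (t ∸ j))     ≡⟨ ⊛-coeff f′ g′ t ⟨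
    (f′ ⊛ g′) t                              ∎
    where open ≡-Reasoning

  ⊛-congˡ : ∀ f {g g′} → g ≗ g′ → f ⊛ g ≗ f ⊛ g′
  ⊛-congˡ f = ⊛-cong {f} (λ _ → refl)

  ⊛-congʳ : ∀ g {f f′} → f ≗ f′ → f ⊛ g ≗ f′ ⊛ g
  ⊛-congʳ g f≗ = ⊛-cong {g = g} f≗ (λ _ → refl)

  ⊕-congˡ : ∀ f {g g′} → g ≗ g′ → f ⊕ g ≗ f ⊕ g′
  ⊕-congˡ f g≗ t = cong (f t +_) (g≗ t)

  •-cong : ∀ a {f f′} → f ≗ f′ → a • f ≗ a • f′
  •-cong a f≗ t = cong (a *_) (f≗ t)

  deriv-cong : ∀ {f g} → f ≗ g → deriv f ≗ deriv g
  deriv-cong f≗ t = cong (suc t *_) (f≗ (suc t))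

  xPow-cong : ∀ j {f g} → f ≗ g → xPow j f ≗ xPow j g
  xPow-cong j f≗ t with j ≤ᵇ t
  ... | true  = f≗ (t ∸ j)
  ... | false = refl

  ⊛-comm : ∀ f g → f ⊛ g ≗ g ⊛ f
  ⊛-comm f g t = begin
    (f ⊛ g) t                                   ≡⟨ ⊛-coeff f g t ⟩
    ∑< (suc t) (λ j → f j * g (t ∸ j))          ≡⟨ ∑<-reverse (suc t) _ ⟩
    ∑< (suc t) (λ j → f (t ∸ j) * g (t ∸ (t ∸ j))) ≡⟨ ∑<-cong (suc t) swap ⟩
    ∑< (suc t) (λ j → g j * f (t ∸ j))          ≡⟨ ⊛-coeff g f t ⟨
    (g ⊛ f) t                                   ∎
    where
    open ≡-Reasoning
    swap : ∀ j → j < suc t → f (t ∸ j) * g (t ∸ (t ∸ j)) ≡ g j * f (t ∸ j)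
    swap j j< = trans (cong (λ i → f (t ∸ j) * g i) (m∸[m∸n]≡n (s≤s⁻¹ j<))) (*-comm (f (t ∸ j)) (g j))

  ⊛-assoc : ∀ f g h → (f ⊛ g) ⊛ h ≗ f ⊛ (g ⊛ h)
  ⊛-assoc f g h t = begin
    ((f ⊛ g) ⊛ h) t
      ≡⟨ ⊛-coeff (f ⊛ g) h t ⟩
    ∑< (suc t) (λ i → (f ⊛ g) i * h (t ∸ i))
      ≡⟨ ∑<-cong (suc t) (λ i _ → trans (cong (_* h (t ∸ i)) (⊛-coeff f g i))
                                        (sym (∑-*ʳ (upTo (suc i)) (h (t ∸ i)) (λ j → f j * g (i ∸ j))))) ⟩
    ∑< (suc t) (λ i → ∑< (suc i) (λ j → f j * g (i ∸ j) * h (t ∸ i)))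
      ≡⟨ ∑<-triangle t (λ j i → f j * g (i ∸ j) * h (t ∸ i)) ⟩
    ∑< (suc t) (λ j → ∑< (suc (t ∸ j)) (λ l → f j * g (j + l ∸ j) * h (t ∸ (j + l))))
      ≡⟨ ∑<-cong (suc t) (λ j _ → trans (∑<-cong (suc (t ∸ j)) (λ l _ → regroup j l))
                                        (trans (∑-*ˡ (upTo (suc (t ∸ j))) (f j) (λ l → g l * h (t ∸ j ∸ l)))
                                               (cong (f j *_) (sym (⊛-coeff g h (t ∸ j)))))) ⟩
    ∑< (suc t) (λ j → f j * (g ⊛ h) (t ∸ j))
      ≡⟨ ⊛-coeff f (g ⊛ h) t ⟨
    (f ⊛ (g ⊛ h)) t
      ∎
    where
    open ≡-Reasoning
    regroup : ∀ j l → f j * g (j + l ∸ j) * h (t ∸ (j + l)) ≡ f j * (g l * h (t ∸ j ∸ l))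
    regroup j l = trans (cong₂ (λ a b → f j * g a * h b) (m+n∸m≡n j l) (sym (∸-+-assoc t j l)))
                        (*-assoc (f j) (g l) _)

  ⊛-identityˡ : ∀ f → one ⊛ f ≗ f
  ⊛-identityˡ f t = begin
    (one ⊛ f) t                                        ≡⟨ ⊛-coeff one f t ⟩
    ∑< (suc t) (λ j → one j * f (t ∸ j))               ≡⟨ ∑<-suc t (λ j → one j * f (t ∸ j)) ⟩
    f t + 0 + ∑< t (λ j → one (suc j) * f (t ∸ suc j)) ≡⟨ cong₂ _+_ (+-identityʳ (f t)) (∑<-zero t (λ _ _ → refl)) ⟩
    f t + 0                                            ≡⟨ +-identityʳ (f t) ⟩
    f t                                                ∎
    where open ≡-Reasoning

  ⊛-distribʳ-⊕ : ∀ h f g → (f ⊕ g) ⊛ h ≗ f ⊛ h ⊕ g ⊛ h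
  ⊛-distribʳ-⊕ h f g t = begin
    ((f ⊕ g) ⊛ h) t                                     ≡⟨ ⊛-coeff (f ⊕ g) h t ⟩
    ∑< (suc t) (λ j → (f j + g j) * h (t ∸ j))          ≡⟨ ∑<-cong (suc t) (λ j _ → *-distribʳ-+ (h (t ∸ j)) (f j) (g j)) ⟩
    ∑< (suc t) (λ j → f j * h (t ∸ j) + g j * h (t ∸ j)) ≡⟨ ∑-+ (upTo (suc t)) (λ j → f j * h (t ∸ j)) (λ j → g j * h (t ∸ j)) ⟩
    ∑< (suc t) (λ j → f j * h (t ∸ j)) + ∑< (suc t) (λ j → g j * h (t ∸ j))
                                                        ≡⟨ cong₂ _+_ (⊛-coeff f h t) (⊛-coeff g h t) ⟨
    (f ⊛ h ⊕ g ⊛ h) t                                   ∎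
    where open ≡-Reasoning

  •-⊛ : ∀ a f g → (a • f) ⊛ g ≗ a • (f ⊛ g)
  •-⊛ a f g t = begin
    ((a • f) ⊛ g) t                            ≡⟨ ⊛-coeff (a • f) g t ⟩
    ∑< (suc t) (λ j → a * f j * g (t ∸ j))     ≡⟨ ∑<-cong (suc t) (λ j _ → *-assoc a (f j) (g (t ∸ j))) ⟩
    ∑< (suc t) (λ j → a * (f j * g (t ∸ j)))   ≡⟨ ∑-*ˡ (upTo (suc t)) a (λ j → f j * g (t ∸ j)) ⟩
    a * ∑< (suc t) (λ j → f j * g (t ∸ j))     ≡⟨ cong (a *_) (⊛-coeff f g t) ⟨
    (a • (f ⊛ g)) t                            ∎
    where open ≡-Reasoning

  ⊛-• : ∀ a f g → f ⊛ (a • g) ≗ a • (f ⊛ g)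
  ⊛-• a f g t = trans (⊛-comm f (a • g) t) (trans (•-⊛ a g f t) (cong (a *_) (⊛-comm g f t)))

  xPow-below : ∀ j f {t} → t < j → xPow j f t ≡ 0
  xPow-below j f t<j rewrite ≤ᵇ-false t<j = refl

  xPow-+ : ∀ j f s → xPow j f (j + s) ≡ f s
  xPow-+ j f s rewrite ≤ᵇ-true (m≤m+n j s) = cong f (m+n∸m≡n j s)

  xPow-⊛ : ∀ j f g → xPow j f ⊛ g ≗ xPow j (f ⊛ g)
  xPow-⊛ j f g t with j ≤? t
  ... | no j≰t = begin
    (xPow j f ⊛ g) t                          ≡⟨ ⊛-coeff (xPow j f) g t ⟩
    ∑< (suc t) (λ i → xPow j f i * g (t ∸ i)) ≡⟨ ∑<-zero (suc t) (λ i i< → cong (_* g (t ∸ i)) (xPow-below j f (<-≤-trans i< (≰⇒> j≰t)))) ⟩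
    0                                         ≡⟨ xPow-below j (f ⊛ g) (≰⇒> j≰t) ⟨
    xPow j (f ⊛ g) t                          ∎
    where open ≡-Reasoning
  ... | yes j≤t rewrite sym (m+[n∸m]≡n j≤t) = begin
    (xPow j f ⊛ g) (j + s)
      ≡⟨ ⊛-coeff (xPow j f) g (j + s) ⟩
    ∑< (suc (j + s)) (λ i → xPow j f i * g (j + s ∸ i))
      ≡⟨ cong (λ n → ∑< n (λ i → xPow j f i * g (j + s ∸ i))) (sym (+-suc j s)) ⟩
    ∑< (j + suc s) (λ i → xPow j f i * g (j + s ∸ i))
      ≡⟨ ∑<-+ j (suc s) (λ i → xPow j f i * g (j + s ∸ i)) ⟩
    ∑< j (λ i → xPow j f i * g (j + s ∸ i)) + ∑< (suc s) (λ i → xPow j f (j + i) * g (j + s ∸ (j + i)))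
      ≡⟨ cong₂ _+_ (∑<-zero j (λ i i<j → cong (_* g (j + s ∸ i)) (xPow-below j f i<j)))
                   (∑<-cong (suc s) (λ i _ → cong₂ _*_ (xPow-+ j f i) (cong g ([m+n]∸[m+o]≡n∸o j s i)))) ⟩
    ∑< (suc s) (λ i → f i * g (s ∸ i))
      ≡⟨ ⊛-coeff f g s ⟨
    (f ⊛ g) s
      ≡⟨ xPow-+ j (f ⊛ g) s ⟨
    xPow j (f ⊛ g) (j + s)
      ∎
    where
    open ≡-Reasoning
    s = t ∸ j

  deriv-⊛ : ∀ f g → deriv (f ⊛ g) ≗ deriv f ⊛ g ⊕ f ⊛ deriv g
  deriv-⊛ f g t = begin
    suc t * (f ⊛ g) (suc t)
      ≡⟨ cong (suc t *_) (⊛-coeff f g (suc t)) ⟩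
    suc t * ∑< (suc (suc t)) F
      ≡⟨ ∑-*ˡ (upTo (suc (suc t))) (suc t) F ⟨
    ∑< (suc (suc t)) (λ i → suc t * F i)
      ≡⟨ ∑<-cong (suc (suc t)) (λ i i< → trans (cong (_* F i) (sym (m+[n∸m]≡n (s≤s⁻¹ i<)))) (*-distribʳ-+ (F i) i (suc t ∸ i))) ⟩
    ∑< (suc (suc t)) (λ i → i * F i + (suc t ∸ i) * F i)
      ≡⟨ ∑-+ (upTo (suc (suc t))) (λ i → i * F i) (λ i → (suc t ∸ i) * F i) ⟩
    ∑< (suc (suc t)) (λ i → i * F i) + ∑< (suc (suc t)) (λ i → (suc t ∸ i) * F i)
      ≡⟨ cong₂ _+_ left right ⟩
    (deriv f ⊛ g) t + (f ⊛ deriv g) t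
      ∎
    where
    open ≡-Reasoning
    F : ℕ → ℕ
    F i = f i * g (suc t ∸ i)
    left : ∑< (suc (suc t)) (λ i → i * F i) ≡ (deriv f ⊛ g) t
    left = begin
      ∑< (suc (suc t)) (λ i → i * F i)                   ≡⟨ ∑<-suc (suc t) (λ i → i * F i) ⟩
      ∑< (suc t) (λ i → suc i * (f (suc i) * g (t ∸ i))) ≡⟨ ∑<-cong (suc t) (λ i _ → sym (*-assoc (suc i) (f (suc i)) (g (t ∸ i)))) ⟩
      ∑< (suc t) (λ i → deriv f i * g (t ∸ i))           ≡⟨ ⊛-coeff (deriv f) g t ⟨
      (deriv f ⊛ g) t                                    ∎
    right : ∑< (suc (suc t)) (λ i → (suc t ∸ i) * F i) ≡ (f ⊛ deriv g) t
    right = begin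
      ∑< (suc (suc t)) (λ i → (suc t ∸ i) * F i)
        ≡⟨ ∑<-last (suc t) (λ i → (suc t ∸ i) * F i) ⟩
      ∑< (suc t) (λ i → (suc t ∸ i) * F i) + (t ∸ t) * F (suc t)
        ≡⟨ cong (λ n → ∑< (suc t) (λ i → (suc t ∸ i) * F i) + n * F (suc t)) (n∸n≡0 t) ⟩
      ∑< (suc t) (λ i → (suc t ∸ i) * F i) + 0
        ≡⟨ +-identityʳ _ ⟩
      ∑< (suc t) (λ i → (suc t ∸ i) * F i)
        ≡⟨ ∑<-cong (suc t) (λ i i< → rearrange i (s≤s⁻¹ i<)) ⟩
      ∑< (suc t) (λ i → f i * deriv g (t ∸ i))
        ≡⟨ ⊛-coeff f (deriv g) t ⟨
      (f ⊛ deriv g) t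
        ∎
      where
      rearrange : ∀ i → i ≤ t → (suc t ∸ i) * F i ≡ f i * deriv g (t ∸ i)
      rearrange i i≤t rewrite +-∸-assoc 1 i≤t =
        trans (sym (*-assoc (suc (t ∸ i)) (f i) _))
              (trans (cong (_* g (suc (t ∸ i))) (*-comm (suc (t ∸ i)) (f i))) (*-assoc (f i) (suc (t ∸ i)) _))

  invPow-+ : ∀ a b → invPow (a + b) ≗ invPow a ⊛ invPow b
  invPow-+ zero    b t = sym (⊛-identityˡ (invPow b) t)
  invPow-+ (suc a) b t = begin
    (geom ⊛ invPow (a + b)) t          ≡⟨ ⊛-congˡ geom (invPow-+ a b) t ⟩
    (geom ⊛ (invPow a ⊛ invPow b)) t   ≡⟨ ⊛-assoc geom (invPow a) (invPow b) t ⟨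
    ((geom ⊛ invPow a) ⊛ invPow b) t   ∎
    where open ≡-Reasoning

  invPow-1 : invPow 1 ≗ geom
  invPow-1 t = trans (⊛-comm geom one t) (⊛-identityˡ geom t)

  deriv-geom : deriv geom ≗ invPow 2
  deriv-geom t = begin
    suc t * 1                            ≡⟨ *-identityʳ (suc t) ⟩
    suc t                                ≡⟨ ∑<-const-1 (suc t) ⟨
    ∑< (suc t) (λ j → 1 * 1)             ≡⟨ ⊛-coeff geom geom t ⟨
    (geom ⊛ geom) t                      ≡⟨ ⊛-congˡ geom invPow-1 t ⟨
    invPow 2 t                           ∎
    where open ≡-Reasoning

  deriv-invPow : ∀ r → deriv (invPow (suc r)) ≗ suc r • invPow (suc (suc r))
  deriv-invPow zero    t = trans (deriv-cong invPow-1 t) (trans (deriv-geom t) (sym (+-identityʳ _)))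
  deriv-invPow (suc r) t = begin
    deriv (geom ⊛ invPow (suc r)) t
      ≡⟨ deriv-⊛ geom (invPow (suc r)) t ⟩
    (deriv geom ⊛ invPow (suc r)) t + (geom ⊛ deriv (invPow (suc r))) t
      ≡⟨ cong₂ _+_ (trans (⊛-congʳ (invPow (suc r)) deriv-geom t) (sym (invPow-+ 2 (suc r) t)))
                   (trans (⊛-congˡ geom (deriv-invPow r) t) (⊛-• (suc r) geom (invPow (suc (suc r))) t)) ⟩
    invPow (suc (suc (suc r))) t + suc r * invPow (suc (suc (suc r))) t
      ∎
    where open ≡-Reasoning

  ⊛-swap : ∀ f g h → f ⊛ (g ⊛ h) ≗ g ⊛ (f ⊛ h)
  ⊛-swap f g h = begin
    f ⊛ (g ⊛ h)  ≈⟨ ⊛-assoc f g h ⟨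
    (f ⊛ g) ⊛ h  ≈⟨ ⊛-congʳ h (⊛-comm f g) ⟩
    (g ⊛ f) ⊛ h  ≈⟨ ⊛-assoc g f h ⟩
    g ⊛ (f ⊛ h)  ∎
    where open ≗-Reasoning

  deriv-⊛-invPow : ∀ f K → deriv (f ⊛ invPow (suc K)) ≗ (deriv f ⊕ suc K • (f ⊛ geom)) ⊛ invPow (suc K)
  deriv-⊛-invPow f K = begin
    deriv (f ⊛ I)                                   ≈⟨ deriv-⊛ f I ⟩
    deriv f ⊛ I ⊕ f ⊛ deriv I                       ≈⟨ ⊕-congˡ (deriv f ⊛ I) (⊛-congˡ f (deriv-invPow K)) ⟩
    deriv f ⊛ I ⊕ f ⊛ (suc K • (geom ⊛ I))          ≈⟨ ⊕-congˡ (deriv f ⊛ I) (⊛-• (suc K) f (geom ⊛ I)) ⟩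
    deriv f ⊛ I ⊕ suc K • (f ⊛ (geom ⊛ I))          ≈⟨ ⊕-congˡ (deriv f ⊛ I) (•-cong (suc K) (⊛-assoc f geom I)) ⟨
    deriv f ⊛ I ⊕ suc K • ((f ⊛ geom) ⊛ I)          ≈⟨ ⊕-congˡ (deriv f ⊛ I) (•-⊛ (suc K) (f ⊛ geom) I) ⟨
    deriv f ⊛ I ⊕ (suc K • (f ⊛ geom)) ⊛ I          ≈⟨ ⊛-distribʳ-⊕ I (deriv f) (suc K • (f ⊛ geom)) ⟨
    (deriv f ⊕ suc K • (f ⊛ geom)) ⊛ I              ∎
    where
    open ≗-Reasoning
    I = invPow (suc K)

  numerator-transfer : ∀ (N M : Series) j c K → 1 ≤ c →
    N ⊛ geom ≗ xPow j (deriv M ⊕ suc K • (M ⊛ geom)) →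
    N ⊛ invPow (suc (K + c)) ≗ xPow j (invPow (c ∸ 1) ⊛ deriv (M ⊛ invPow (suc K)))
  numerator-transfer N M j (suc c′) K _ N/geom = begin
    N ⊛ invPow (suc (K + suc c′))   ≈⟨ ⊛-congˡ N (⊛-congˡ geom split) ⟩
    N ⊛ (geom ⊛ (Ic ⊛ IK))          ≈⟨ ⊛-assoc N geom (Ic ⊛ IK) ⟨
    (N ⊛ geom) ⊛ (Ic ⊛ IK)          ≈⟨ ⊛-congʳ (Ic ⊛ IK) N/geom ⟩
    xPow j Q ⊛ (Ic ⊛ IK)            ≈⟨ xPow-⊛ j Q (Ic ⊛ IK) ⟩
    xPow j (Q ⊛ (Ic ⊛ IK))          ≈⟨ xPow-cong j (⊛-swap Q Ic IK) ⟩
    xPow j (Ic ⊛ (Q ⊛ IK))          ≈⟨ xPow-cong j (⊛-congˡ Ic (deriv-⊛-invPow M K)) ⟨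
    xPow j (Ic ⊛ deriv (M ⊛ IK))    ∎
    where
    open ≗-Reasoning
    Ic = invPow c′
    IK = invPow (suc K)
    Q = deriv M ⊕ suc K • (M ⊛ geom)
    split : invPow (K + suc c′) ≗ Ic ⊛ IK
    split t = trans (cong (λ n → invPow n t) (trans (+-comm K (suc c′)) (sym (+-suc c′ K)))) (invPow-+ c′ (suc K) t)

  ⊛-geom : ∀ f t → (f ⊛ geom) t ≡ ∑< (suc t) f
  ⊛-geom f t = trans (⊛-coeff f geom t) (∑<-cong (suc t) (λ i _ → *-identityʳ (f i)))

  -- The numerators of G and g

  numG≗A : ∀ {n} (k : Vec ℕ n) → VecAll.All (1 ≤_) k → 1 ≤ n → numG k ≗ A k
  numG≗A {n} k k⁺ 1≤n zero    = sym (A-zero k (≤-trans 1≤n (length≤total k k⁺)))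
  numG≗A {n} k k⁺ 1≤n (suc i) with suc i ≤ᵇ n in eq
  ... | true  = refl
  ... | false = sym (A-above n k k⁺ (suc i) (≤ᵇ≡false⇒> eq))

  numg≡A-reversed : ∀ {n} (k : Vec ℕ n) → VecAll.All (1 ≤_) k → 1 ≤ n → ∀ i → numg k i ≡ A k (suc (total k) ∸ i)
  numg≡A-reversed {n} k k⁺ 1≤n i with suc (total k) ∸ n ≤ᵇ i in lower | i ≤ᵇ total k in upper
  ... | true  | true  = refl
  ... | false | _     = sym (A-above n k k⁺ (suc (total k) ∸ i) (m+n≤o⇒m≤o∸n (suc n) n+i<))
    where
    n+i< : suc n + i ≤ suc (total k)
    n+i< = subst (_≤ suc (total k)) (trans (+-comm (suc i) n) (+-suc n i))
             (m≤o∸n⇒m+n≤o (suc i) (m≤n⇒m≤1+n (length≤total k k⁺)) (≤ᵇ≡false⇒> lower))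
  ... | true  | false = sym (trans (cong (A k) (m≤n⇒m∸n≡0 (≤ᵇ≡false⇒> {i} {total k} upper)))
                                  (A-zero k (≤-trans 1≤n (length≤total k k⁺))))

  module Numerators {m} (k : Vec ℕ (suc m)) (k⁺ : VecAll.All (1 ≤_) k) (1≤m : 1 ≤ m) where

    k′  = init k
    k′⁺ = All-init k k⁺
    K′  = total k′
    c   = last k

    A′ : ℕ → ℕ
    A′ = A k′

    A-rec : ∀ j → A k (suc j) ≡ suc j * A′ (suc j) + (suc K′ ∸ j) * A′ j
    A-rec = A-suc k (All-last k k⁺)

    A-k-zero : A k 0 ≡ 0
    A-k-zero = A-zero k (≤-trans (s≤s z≤n) (length≤total k k⁺))

    A′-zero : A′ 0 ≡ 0
    A′-zero = A-zero k′ (≤-trans 1≤m (length≤total k′ k′⁺))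

    m≤K′ : m ≤ K′
    m≤K′ = length≤total k′ k′⁺

    total-k : total k ≡ K′ + c
    total-k = trans (cong total (init-∷ʳ-last k)) (total-∷ʳ k′ c)

    A-partial-sum : ∀ u → ∑< (suc (suc u)) (A k) ≡ suc u * A′ (suc u) + suc K′ * ∑< (suc u) A′
    A-partial-sum zero = begin
      A k 0 + (A k 1 + 0)           ≡⟨ cong₂ _+_ A-k-zero (+-identityʳ (A k 1)) ⟩
      A k 1                         ≡⟨ A-rec 0 ⟩
      1 * A′ 1 + suc K′ * A′ 0      ≡⟨ cong (λ a → 1 * A′ 1 + suc K′ * a) (+-identityʳ (A′ 0)) ⟨
      1 * A′ 1 + suc K′ * (A′ 0 + 0) ∎
      where open ≡-Reasoning
    A-partial-sum (suc u) = begin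
      ∑< (suc (suc (suc u))) (A k)
        ≡⟨ ∑<-last (suc (suc u)) (A k) ⟩
      ∑< (suc (suc u)) (A k) + A k (suc (suc u))
        ≡⟨ cong₂ _+_ (A-partial-sum u) (A-rec (suc u)) ⟩
      (a * A′ a + suc K′ * S) + (suc a * A′ (suc a) + (suc K′ ∸ a) * A′ a)
        ≡⟨ regroup a (A′ a) (suc K′ * S) (suc a * A′ (suc a)) (suc K′ ∸ a) ⟩
      suc a * A′ (suc a) + (suc K′ * S + (a + (suc K′ ∸ a)) * A′ a)
        ≡⟨ cong (λ n → suc a * A′ (suc a) + (suc K′ * S + n)) complete ⟩
      suc a * A′ (suc a) + (suc K′ * S + suc K′ * A′ a)
        ≡⟨ cong (suc a * A′ (suc a) +_) (*-distribˡ-+ (suc K′) S (A′ a)) ⟨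
      suc a * A′ (suc a) + suc K′ * (S + A′ a)
        ≡⟨ cong (λ n → suc a * A′ (suc a) + suc K′ * n) (∑<-last (suc u) A′) ⟨
      suc a * A′ (suc a) + suc K′ * ∑< (suc a) A′
        ∎
      where
      open ≡-Reasoning
      a = suc u
      S = ∑< (suc u) A′
      regroup : ∀ a x y z b → (a * x + y) + (z + b * x) ≡ z + (y + (a + b) * x)
      regroup = solve-∀
      complete : (a + (suc K′ ∸ a)) * A′ a ≡ suc K′ * A′ a
      complete with a ≤? suc K′
      ... | yes a≤ = cong (_* A′ a) (m+[n∸m]≡n a≤)
      ... | no a≰ rewrite A-above m k′ k′⁺ a (≤-<-trans m≤K′ (<-trans (n<1+n K′) (≰⇒> a≰))) =
        trans (*-zeroʳ (a + (suc K′ ∸ a))) (sym (*-zeroʳ (suc K′)))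

    numG-key : numG k ⊛ geom ≗ xPow 1 (deriv (numG k′) ⊕ suc K′ • (numG k′ ⊛ geom))
    numG-key zero    =
      trans (⊛-geom (numG k) 0) (trans (cong (_+ 0) (numG≗A k k⁺ (s≤s z≤n) 0)) (trans (+-identityʳ _) A-k-zero))
    numG-key (suc u) = begin
      (numG k ⊛ geom) (suc u)                          ≡⟨ ⊛-geom (numG k) (suc u) ⟩
      ∑< (suc (suc u)) (numG k)                        ≡⟨ ∑<-cong (suc (suc u)) (λ i _ → numG≗A k k⁺ (s≤s z≤n) i) ⟩
      ∑< (suc (suc u)) (A k)                           ≡⟨ A-partial-sum u ⟩
      suc u * A′ (suc u) + suc K′ * ∑< (suc u) A′      ≡⟨ cong₂ (λ a b → suc u * a + suc K′ * b) (numG≗A k′ k′⁺ 1≤m (suc u)) numG′-sum ⟨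
      suc u * numG k′ (suc u) + suc K′ * (numG k′ ⊛ geom) u ∎
      where
      open ≡-Reasoning
      numG′-sum : (numG k′ ⊛ geom) u ≡ ∑< (suc u) A′
      numG′-sum = trans (⊛-geom (numG k′) u) (∑<-cong (suc u) (λ i _ → numG≗A k′ k′⁺ 1≤m i))

    B B′ : ℕ → ℕ
    B  i = A k (suc K′ ∸ i)
    B′ i = A′ (suc K′ ∸ i)

    B-step : ∀ u → suc u * B′ (suc u) + A k (K′ ∸ u) ≡ suc (suc u) * B′ (suc (suc u)) + suc K′ * B′ (suc u)
    B-step u with suc u ≤? K′
    ... | no u≮K′ rewrite m≤n⇒m∸n≡0 (<⇒≤ (≰⇒> u≮K′)) | m≤n⇒m∸n≡0 (≰⇒> u≮K′) | A′-zero | A-k-zero =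
      trans (cong (_+ 0) (*-zeroʳ (suc u))) (sym (cong₂ _+_ (*-zeroʳ (suc (suc u))) (*-zeroʳ (suc K′))))
    ... | yes u<K′ = begin
      suc u * A′ (K′ ∸ u) + A k (K′ ∸ u)
        ≡⟨ cong (λ i → suc u * A′ i + A k i) K′∸u ⟩
      suc u * A′ (suc v) + A k (suc v)
        ≡⟨ cong (suc u * A′ (suc v) +_) (A-rec v) ⟩
      suc u * A′ (suc v) + (suc v * A′ (suc v) + (suc K′ ∸ v) * A′ v)
        ≡⟨ cong (λ n → suc u * A′ (suc v) + (suc v * A′ (suc v) + n * A′ v)) suc-K′∸v ⟩
      suc u * A′ (suc v) + (suc v * A′ (suc v) + suc (suc u) * A′ v)
        ≡⟨ regroup u v (A′ (suc v)) (A′ v) ⟩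
      suc (suc u) * A′ v + suc (suc u + v) * A′ (suc v)
        ≡⟨ cong (λ n → suc (suc u) * A′ v + suc n * A′ (suc v)) K′≡ ⟨
      suc (suc u) * A′ v + suc K′ * A′ (suc v)
        ≡⟨ cong (λ i → suc (suc u) * A′ v + suc K′ * A′ i) K′∸u ⟨
      suc (suc u) * A′ (K′ ∸ suc u) + suc K′ * A′ (K′ ∸ u)
        ∎
      where
      open ≡-Reasoning
      v = K′ ∸ suc u
      K′≡ : K′ ≡ suc u + v
      K′≡ = sym (m+[n∸m]≡n u<K′)
      K′∸u : K′ ∸ u ≡ suc v
      K′∸u = trans (cong (_∸ u) K′≡) (trans (cong (_∸ u) (sym (+-suc u v))) (m+n∸m≡n u (suc v)))
      suc-K′∸v : suc K′ ∸ v ≡ suc (suc u)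
      suc-K′∸v = trans (cong (λ n → suc n ∸ v) (trans K′≡ (+-comm (suc u) v)))
                       (trans (cong (_∸ v) (sym (+-suc v (suc u)))) (m+n∸m≡n v (suc (suc u))))
      regroup : ∀ u v x y → suc u * x + (suc v * x + suc (suc u) * y) ≡ suc (suc u) * y + suc (suc u + v) * x
      regroup = solve-∀

    B-partial-sum : ∀ u → ∑< (suc u) B ≡ suc u * B′ (suc u) + suc K′ * ∑< (suc u) B′
    B-partial-sum zero = begin
      A k (suc K′) + 0                               ≡⟨ +-identityʳ _ ⟩
      A k (suc K′)                                   ≡⟨ A-rec K′ ⟩
      suc K′ * A′ (suc K′) + (suc K′ ∸ K′) * A′ K′   ≡⟨ cong (λ n → suc K′ * A′ (suc K′) + n * A′ K′) (m+n∸n≡m 1 K′) ⟩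
      suc K′ * A′ (suc K′) + 1 * A′ K′               ≡⟨ +-comm (suc K′ * A′ (suc K′)) _ ⟩
      1 * A′ K′ + suc K′ * A′ (suc K′)               ≡⟨ cong (λ n → 1 * A′ K′ + suc K′ * n) (+-identityʳ _) ⟨
      1 * B′ 1 + suc K′ * (B′ 0 + 0)                 ∎
      where open ≡-Reasoning
    B-partial-sum (suc u) = begin
      ∑< (suc (suc u)) B
        ≡⟨ ∑<-last (suc u) B ⟩
      ∑< (suc u) B + B (suc u)
        ≡⟨ cong (_+ B (suc u)) (B-partial-sum u) ⟩
      (suc u * B′ (suc u) + suc K′ * S) + A k (K′ ∸ u)
        ≡⟨ regroup (suc u * B′ (suc u)) (suc K′ * S) (A k (K′ ∸ u)) ⟩
      (suc u * B′ (suc u) + A k (K′ ∸ u)) + suc K′ * S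
        ≡⟨ cong (_+ suc K′ * S) (B-step u) ⟩
      (suc (suc u) * B′ (suc (suc u)) + suc K′ * B′ (suc u)) + suc K′ * S
        ≡⟨ regroup′ (suc (suc u) * B′ (suc (suc u))) (suc K′) (B′ (suc u)) S ⟩
      suc (suc u) * B′ (suc (suc u)) + suc K′ * (S + B′ (suc u))
        ≡⟨ cong (λ n → suc (suc u) * B′ (suc (suc u)) + suc K′ * n) (∑<-last (suc u) B′) ⟨
      suc (suc u) * B′ (suc (suc u)) + suc K′ * ∑< (suc (suc u)) B′
        ∎
      where
      open ≡-Reasoning
      S = ∑< (suc u) B′
      regroup : ∀ x y z → (x + y) + z ≡ (x + z) + y
      regroup = solve-∀
      regroup′ : ∀ x a y s → (x + a * y) + a * s ≡ x + a * (s + y)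
      regroup′ = solve-∀

    numg-below : ∀ i → i < c → numg k i ≡ 0
    numg-below i i<c = trans (numg≡A-reversed k k⁺ (s≤s z≤n) i) (A-above (suc m) k k⁺ _ (m+n≤o⇒m≤o∸n (suc (suc m)) m+i<))
      where
      m+i< : suc (suc m) + i ≤ suc (total k)
      m+i< = s≤s (subst (_≤ total k) (+-suc m i) (subst (m + suc i ≤_) (sym total-k) (+-mono-≤ m≤K′ i<c)))

    numg-shift : ∀ i → numg k (c + i) ≡ B i
    numg-shift i = trans (numg≡A-reversed k k⁺ (s≤s z≤n) (c + i)) (cong (A k) shift)
      where
      shift : suc (total k) ∸ (c + i) ≡ suc K′ ∸ i
      shift = trans (cong (λ n → suc n ∸ (c + i)) (trans total-k (+-comm K′ c)))
                    (trans (cong (_∸ (c + i)) (sym (+-suc c K′))) ([m+n]∸[m+o]≡n∸o c (suc K′) i))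

    numg-key : numg k ⊛ geom ≗ xPow c (deriv (numg k′) ⊕ suc K′ • (numg k′ ⊛ geom))
    numg-key t with c ≤? t
    ... | no c≰t = begin
      (numg k ⊛ geom) t   ≡⟨ ⊛-geom (numg k) t ⟩
      ∑< (suc t) (numg k) ≡⟨ ∑<-zero (suc t) (λ i i< → numg-below i (<-≤-trans i< (≰⇒> c≰t))) ⟩
      0                   ≡⟨ xPow-below c (deriv (numg k′) ⊕ suc K′ • (numg k′ ⊛ geom)) (≰⇒> c≰t) ⟨
      xPow c (deriv (numg k′) ⊕ suc K′ • (numg k′ ⊛ geom)) t ∎
      where open ≡-Reasoning
    ... | yes c≤t rewrite sym (m+[n∸m]≡n c≤t) = begin
      (numg k ⊛ geom) (c + u)
        ≡⟨ ⊛-geom (numg k) (c + u) ⟩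
      ∑< (suc (c + u)) (numg k)
        ≡⟨ cong (λ n → ∑< n (numg k)) (sym (+-suc c u)) ⟩
      ∑< (c + suc u) (numg k)
        ≡⟨ ∑<-+ c (suc u) (numg k) ⟩
      ∑< c (numg k) + ∑< (suc u) (λ i → numg k (c + i))
        ≡⟨ cong₂ _+_ (∑<-zero c numg-below) (∑<-cong (suc u) (λ i _ → numg-shift i)) ⟩
      ∑< (suc u) B
        ≡⟨ B-partial-sum u ⟩
      suc u * B′ (suc u) + suc K′ * ∑< (suc u) B′
        ≡⟨ cong₂ (λ a b → suc u * a + suc K′ * b) (numg≡A-reversed k′ k′⁺ 1≤m (suc u)) numg′-sum ⟨
      suc u * numg k′ (suc u) + suc K′ * (numg k′ ⊛ geom) u
        ≡⟨ xPow-+ c (deriv (numg k′) ⊕ suc K′ • (numg k′ ⊛ geom)) u ⟨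
      xPow c (deriv (numg k′) ⊕ suc K′ • (numg k′ ⊛ geom)) (c + u)
        ∎
      where
      open ≡-Reasoning
      u = t ∸ c
      numg′-sum : (numg k′ ⊛ geom) u ≡ ∑< (suc u) B′
      numg′-sum = trans (⊛-geom (numg k′) u) (∑<-cong (suc u) (λ i _ → numg≡A-reversed k′ k′⁺ 1≤m i))

open import Data.Nat using (ℕ; suc; _+_; _*_; _∸_; _≤_; _<_; _≤?_)
open import Data.Nat.Properties using (≤-<-trans; <-trans; n<1+n; ≰⇒>)
open import Data.Integer using (ℤ; +_; _-_) renaming (_+_ to _+ℤ_; _*_ to _*ℤ_)
import Data.Integer.Properties as ℤ
open import Data.Vec using (Vec; []; _∷_; init; last)
open import Data.Vec.Relation.Unary.All using (All)
open import Data.Product using (_×_; _,_)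
open import Relation.Binary.PropositionalEquality using (_≡_; cong; cong₂; sym; trans; module ≡-Reasoning)
open import Relation.Nullary using (yes; no)

-- Over ℕ the factor suc K′ ∸ j truncates, but for j > suc K′ the term it multiplies vanishes.
A-sucℤ : ∀ m (k : Vec ℕ (suc m)) → All (1 ≤_) k → ∀ j →
  + A k (suc j) ≡ (+ suc j) *ℤ (+ A (init k) (suc j)) +ℤ ((+ suc (total (init k)) - + j) *ℤ (+ A (init k) j))
A-sucℤ m k k⁺ j = begin
  + A k (suc j)
    ≡⟨ cong +_ (A-suc k (All-last k k⁺) j) ⟩
  + (suc j * A k′ (suc j) + (suc K′ ∸ j) * A k′ j)
    ≡⟨ ℤ.pos-+ (suc j * A k′ (suc j)) _ ⟩
  + (suc j * A k′ (suc j)) +ℤ + ((suc K′ ∸ j) * A k′ j)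
    ≡⟨ cong₂ _+ℤ_ (ℤ.pos-* (suc j) _) (ℤ.pos-* (suc K′ ∸ j) (A k′ j)) ⟩
  + suc j *ℤ + A k′ (suc j) +ℤ + (suc K′ ∸ j) *ℤ + A k′ j
    ≡⟨ cong (+ suc j *ℤ + A k′ (suc j) +ℤ_) truncation ⟩
  + suc j *ℤ + A k′ (suc j) +ℤ (+ suc K′ - + j) *ℤ + A k′ j
    ∎
  where
  open ≡-Reasoning
  k′ = init k
  K′ = total k′
  truncation : + (suc K′ ∸ j) *ℤ + A k′ j ≡ (+ suc K′ - + j) *ℤ + A k′ j
  truncation with j ≤? suc K′
  ... | yes j≤ = cong (_*ℤ + A k′ j) (sym (trans (ℤ.m-n≡m⊖n (suc K′) j) (ℤ.⊖-≥ j≤)))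
  ... | no j≰ rewrite A-above m k′ (All-init k k⁺) j
                        (≤-<-trans (length≤total k′ (All-init k k⁺)) (<-trans (n<1+n K′) (≰⇒> j≰))) =
    trans (ℤ.*-zeroʳ (+ (suc K′ ∸ j))) (sym (ℤ.*-zeroʳ (+ suc K′ - + j)))

lemma1 : (m : ℕ) → 1 ≤ m → (k : Vec ℕ (suc m)) → All (λ x → 1 ≤ x) k →
    ((j : ℕ) → + A k (suc j) ≡
        (+ suc j) *ℤ (+ A (init k) (suc j))
        +ℤ ((+ suc (total (init k)) - + j) *ℤ (+ A (init k) j)))
    × ((c : ℕ) → 1 ≤ c → A (c ∷ []) 1 ≡ 1)
    × (A k 0 ≡ 0)
    × ((i : ℕ) → suc m < i → A k i ≡ 0)
    × ((t : ℕ) → G k t ≡ xPow 1 (invPow (last k ∸ 1) ⊛ deriv (G (init k))) t)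
    × ((t : ℕ) → g k t ≡ xPow (last k) (invPow (last k ∸ 1) ⊛ deriv (g (init k))) t)
lemma1 m 1≤m k k⁺ =
  A-sucℤ m k k⁺ , A-singleton , A-k-zero , A-above (suc m) k k⁺ , G-identity , g-identity
  where
  open Numerators k k⁺ 1≤m
  1≤c : 1 ≤ c
  1≤c = All-last k k⁺
  G-identity : (t : ℕ) → G k t ≡ xPow 1 (invPow (c ∸ 1) ⊛ deriv (G k′)) t
  G-identity t = trans (cong (λ K → (numG k ⊛ invPow (suc K)) t) total-k)
                       (numerator-transfer (numG k) (numG k′) 1 c K′ 1≤c numG-key t)
  g-identity : (t : ℕ) → g k t ≡ xPow c (invPow (c ∸ 1) ⊛ deriv (g k′)) t
  g-identity t = trans (cong (λ K → (numg k ⊛ invPow (suc K)) t) total-k)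
                       (numerator-transfer (numg k) (numg k′) c c K′ 1≤c numg-key t)
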